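{- Let $n, d, \mu, S \ge 1$, let $k \ge 1$ be an integer and let $\eta \in (0, 1)$. Suppose that $d \ge 2^{14} k^3 S^2 \mu n^{1/k}$. Let $G$ be a properly edge-coloured graph on $n$ vertices with minimum degree at least $\frac{d}{2}$ and maximum degree at most $\mu d$. Then $\hom^*(C_{2k}) \le \frac{1}{S} \hom(C_{2k})$.
   Context: In a graph $G$, for vertices $x,y$, $\mathrm{Hom}_{x,y}(C_{2k})$ is the family of closed walks $(x_1,\dots,x_{2k})$ of length $2k$ (consecutive vertices adjacent, and $x_{2k}x_1$ an edge) with $x_1=x$ and $x_{k+1}=y$; $\hom_{x,y}(C_{2k})=|\mathrm{Hom}_{x,y}(C_{2k})|$ and $\hom(C_{2k})=\sum_{x,y\in V(G)}\hom_{x,y}(C_{2k})$. In a properly edge-coloured graph (edges sharing a vertex have distinct colours), $\mathrm{Hom}^*_{x,y}(C_{2k})$ is the subfamily of walks in $\mathrm{Hom}_{x,y}(C_{2k})$ that do not form a rainbow copy of $C_{2k}$ (i.e. either two of the $2k$ vertices coincide or two of the $2k$ edges have the same colour), $\mathrm{Hom}^*(C_{2k})=\bigcup_{x,y}\mathrm{Hom}^*_{x,y}(C_{2k})$ and $\hom^*(C_{2k})=|\mathrm{Hom}^*(C_{2k})|$.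
   Formalization: The parameters d, μ, S and η take rational values. -}

module Defs where

open import Data.Bool using (Bool; true; false; _∧_; not; if_then_else_)
open import Data.Nat using (ℕ; zero; suc; _+_; _*_; _≟_)
open import Data.Fin using (Fin; toℕ)
open import Data.List using (List; []; _∷_; _++_; [_]; zip; map; filter; length)
open import Data.Bool.ListAction using (all; any)
open import Data.Nat.ListAction using (sum)
open import Data.Vec using (Vec; []; _∷_; toList; lookup; allFin)
open import Data.Product using (_×_; _,_)
open import Data.Integer using (+_)
open import Data.Rational using (ℚ; _/_; 1ℚ) renaming (_*_ to _*ℚ_)
open import Relation.Nullary.Decidable using (⌊_⌋)
open import Relation.Nullary using (¬_)
open import Relation.Binary.PropositionalEquality using (_≡_; _≢_)

record Graph (n : ℕ) : Set where
  field
    adj     : Fin n → Fin n → Bool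
    symm    : ∀ x y → adj x y ≡ adj y x
    irrefl  : ∀ x → adj x x ≡ false

open Graph public

record ProperEdgeColouring {n : ℕ} (G : Graph n) : Set where
  field
    col    : Fin n → Fin n → ℕ
    colSym : ∀ x y → adj G x y ≡ true → col x y ≡ col y x
    proper : ∀ x y z → adj G x y ≡ true → adj G x z ≡ true → y ≢ z →
             col x y ≢ col x z

open ProperEdgeColouring public

deg : ∀ {n} → Graph n → Fin n → ℕ
deg {n} G x = length (filter (λ y → adj G x y ≡? true) (toList (allFin n)))
  where
  open import Data.Bool.Properties using () renaming (_≟_ to _≡?_)

countVec : (n m : ℕ) → (Vec (Fin n) m → Bool) → ℕ
countVec n zero P = if P [] then 1 else 0
countVec n (suc m) P = sum (map (λ i → countVec n m (λ w → P (i ∷ w))) (toList (allFin n)))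

cycEdges : {A : Set} → List A → List (A × A)
cycEdges [] = []
cycEdges (x ∷ xs) = zip (x ∷ xs) (xs ++ [ x ])

distinctℕ : List ℕ → Bool
distinctℕ [] = true
distinctℕ (x ∷ xs) = not (any (λ y → ⌊ x ≟ y ⌋) xs) ∧ distinctℕ xs

module _ {n : ℕ} (G : Graph n) (c : ProperEdgeColouring G) where

  isClosedWalk : ∀ {m} → Vec (Fin n) m → Bool
  isClosedWalk w = all (λ { (a , b) → adj G a b }) (cycEdges (toList w))

  isRainbow : ∀ {m} → Vec (Fin n) m → Bool
  isRainbow w = distinctℕ (map toℕ (toList w))
              ∧ distinctℕ (map (λ { (a , b) → col c a b }) (cycEdges (toList w)))

  -- hom_{x,y}(C_{2k}): closed walks (x_1..x_{2k}) with x_1 = x and x_{k+1} = y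
  -- (here positions are 0-indexed: index 0 and index k)
  homxy : (k : ℕ) → Fin n → Fin n → ℕ
  homxy k x y = countVec n (k + k) (λ w → isClosedWalk w ∧ startsAt w)
    where
    open import Data.Fin.Properties using () renaming (_≟_ to _≟F_)
    atIdx : ∀ {m} → Vec (Fin n) m → ℕ → Fin n → Bool
    atIdx [] _ _ = false
    atIdx (v ∷ _) zero z = ⌊ v ≟F z ⌋
    atIdx (_ ∷ vs) (suc i) z = atIdx vs i z
    startsAt : Vec (Fin n) (k + k) → Bool
    startsAt w = atIdx w 0 x ∧ atIdx w k y

  hom : (k : ℕ) → ℕ
  hom k = sum (map (λ x → sum (map (λ y → homxy k x y) (toList (allFin n)))) (toList (allFin n)))

  -- hom*(C_{2k}) = |⋃_{x,y} Hom*_{x,y}(C_{2k})| : the number of closed walks of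
  -- length 2k that do not form a rainbow copy of C_{2k}
  homStar : (k : ℕ) → ℕ
  homStar k = countVec n (k + k) (λ w → isClosedWalk w ∧ not (isRainbow w))

ℕtoℚ : ℕ → ℚ
ℕtoℚ m = (+ m) / 1

_^ℚ_ : ℚ → ℕ → ℚ
q ^ℚ zero = 1ℚ
q ^ℚ suc m = q *ℚ (q ^ℚ m)

{-# OPTIONS --safe #-}
-- Let A be the adjacency matrix, so that hom(C₂ₖ) = tr A²ᵏ. A closed walk of length 2k that is not
-- rainbow has two edges, at positions i < j, with the same first vertex or the same colour c.
-- Splitting this coincidence over c counts such walks by ∑_c tr(M_c Aᵃ M_c Aᵇ), a + b = 2k − 2,
-- where M_c is A restricted to the edges leaving vertex c, or to the edges of colour c.
-- By Cauchy–Schwarz, p ↦ ∑_c tr(M_c Aᵖ M_c A²ᵏ⁻²⁻ᵖ) is largest at an end of its range, and there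
-- the absence of loops, resp. properness of the colouring, bounds it by Δ · tr A²ᵏ⁻². Over the
-- (2k)² position pairs this gives hom* ≤ 8k² Δ hom(C₂ₖ₋₂). Finally log-convexity of
-- j ↦ tr A²ʲ gives hom(C₂ₖ₋₂)ᵏ ≤ n hom(C₂ₖ)ᵏ⁻¹, while hom(C₂ₖ) ≥ δ²ᵏ ≥ (d/2)²ᵏ, and the
-- assumed lower bound on d closes the estimate S · hom* ≤ hom.
module Submission where

open import Defs
open import Data.Nat using (ℕ; suc; _≥_)
open import Data.Fin using (Fin)

module Sums where

  open import Data.Nat
  open import Data.Nat.Properties
  open import Data.Nat.ListAction using (sum)
  open import Data.Nat.Solver using (module +-*-Solver)
  open import Data.List using (List; []; _∷_; map; _++_; length; concatMap)
  open import Data.List.Membership.Propositional using (_∈_)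
  open import Data.List.Relation.Unary.Any using (here; there)
  open import Data.Bool using (Bool; true; false; _∧_)
  open import Data.Product using (_,_)
  open import Data.Sum using (inj₁; inj₂)
  open import Function using (_∘_)
  open import Function.Definitions using (Injective)
  open import Relation.Binary.Definitions using (DecidableEquality)
  open import Relation.Binary.PropositionalEquality
  open import Relation.Nullary using (yes; no; contradiction)
  open import Relation.Nullary.Decidable using (isYes)
  open +-*-Solver using (solve; _:=_; _:+_; _:*_; con)

  𝟙 : Bool → ℕ
  𝟙 true = 1
  𝟙 false = 0

  𝟙-∧ : ∀ a b → 𝟙 (a ∧ b) ≡ 𝟙 a * 𝟙 b
  𝟙-∧ true b = sym (+-identityʳ (𝟙 b))
  𝟙-∧ false b = refl

  𝟙-idem : ∀ b → 𝟙 b * 𝟙 b ≡ 𝟙 b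
  𝟙-idem true = refl
  𝟙-idem false = refl

  ∑ : {A : Set} → List A → (A → ℕ) → ℕ
  ∑ l f = sum (map f l)

  infix 5 ∑
  syntax ∑ l (λ x → e) = ∑[ x ∈ l ] e

  module _ {A : Set} where

    ∑-cong : ∀ (l : List A) {f g : A → ℕ} → (∀ x → f x ≡ g x) → ∑ l f ≡ ∑ l g
    ∑-cong [] e = refl
    ∑-cong (x ∷ l) e = cong₂ _+_ (e x) (∑-cong l e)

    ∑-mono-≤ : ∀ (l : List A) {f g : A → ℕ} → (∀ x → f x ≤ g x) → ∑ l f ≤ ∑ l g
    ∑-mono-≤ [] e = z≤n
    ∑-mono-≤ (x ∷ l) e = +-mono-≤ (e x) (∑-mono-≤ l e)

    ∑-+ : ∀ (l : List A) (f g : A → ℕ) → (∑[ x ∈ l ] f x + g x) ≡ ∑ l f + ∑ l g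
    ∑-+ [] f g = refl
    ∑-+ (x ∷ l) f g = begin
        f x + g x + (∑[ y ∈ l ] f y + g y)  ≡⟨ cong (f x + g x +_) (∑-+ l f g) ⟩
        f x + g x + (∑ l f + ∑ l g)        ≡⟨ solve 4 (λ a b c d → a :+ b :+ (c :+ d) := a :+ c :+ (b :+ d)) refl (f x) (g x) (∑ l f) (∑ l g) ⟩
        f x + ∑ l f + (g x + ∑ l g)        ∎
      where open ≡-Reasoning

    ∑-*ˡ : ∀ (l : List A) (a : ℕ) (f : A → ℕ) → (∑[ x ∈ l ] a * f x) ≡ a * ∑ l f
    ∑-*ˡ [] a f = sym (*-zeroʳ a)
    ∑-*ˡ (x ∷ l) a f = trans (cong (a * f x +_) (∑-*ˡ l a f)) (sym (*-distribˡ-+ a (f x) _))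

    ∑-*ʳ : ∀ (l : List A) (a : ℕ) (f : A → ℕ) → (∑[ x ∈ l ] f x * a) ≡ ∑ l f * a
    ∑-*ʳ l a f = trans (∑-cong l (λ x → *-comm (f x) a)) (trans (∑-*ˡ l a f) (*-comm a _))

    ∑-zero : ∀ (l : List A) → (∑[ _ ∈ l ] 0) ≡ 0
    ∑-zero [] = refl
    ∑-zero (x ∷ l) = ∑-zero l

    ∑-const : ∀ (l : List A) (a : ℕ) → (∑[ _ ∈ l ] a) ≡ length l * a
    ∑-const [] a = refl
    ∑-const (x ∷ l) a = cong (a +_) (∑-const l a)

    ∑-bounded : ∀ (l : List A) (f : A → ℕ) (b : ℕ) → (∀ x → x ∈ l → f x ≤ b) → ∑ l f ≤ length l * b
    ∑-bounded [] f b e = z≤n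
    ∑-bounded (x ∷ l) f b e = +-mono-≤ (e x (here refl)) (∑-bounded l f b (λ y y∈ → e y (there y∈)))

    term≤∑ : ∀ (l : List A) (f : A → ℕ) {x} → x ∈ l → f x ≤ ∑ l f
    term≤∑ (y ∷ l) f (here refl) = m≤m+n (f y) (∑ l f)
    term≤∑ (y ∷ l) f (there x∈) = ≤-trans (term≤∑ l f x∈) (m≤n+m (∑ l f) (f y))

    ∑-++ : ∀ (l m : List A) (f : A → ℕ) → ∑ (l ++ m) f ≡ ∑ l f + ∑ m f
    ∑-++ [] m f = refl
    ∑-++ (x ∷ l) m f = trans (cong (f x +_) (∑-++ l m f)) (sym (+-assoc (f x) _ _))

  module _ {A B : Set} where

    ∑-comm : ∀ (l : List A) (m : List B) (f : A → B → ℕ) →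
      (∑[ x ∈ l ] ∑[ y ∈ m ] f x y) ≡ (∑[ y ∈ m ] ∑[ x ∈ l ] f x y)
    ∑-comm [] m f = sym (∑-zero m)
    ∑-comm (x ∷ l) m f = trans (cong (∑ m (f x) +_) (∑-comm l m f))
                               (sym (∑-+ m (f x) (λ y → ∑[ x ∈ l ] f x y)))

    ∑-map : ∀ (h : A → B) (l : List A) (f : B → ℕ) → ∑ (map h l) f ≡ ∑ l (f ∘ h)
    ∑-map h [] f = refl
    ∑-map h (x ∷ l) f = cong (f (h x) +_) (∑-map h l f)

    ∑-concatMap : ∀ (g : A → List B) (l : List A) (f : B → ℕ) →
      ∑ (concatMap g l) f ≡ (∑[ x ∈ l ] ∑ (g x) f)
    ∑-concatMap g [] f = refl
    ∑-concatMap g (x ∷ l) f = trans (∑-++ (g x) (concatMap g l) f) (cong (∑ (g x) f +_) (∑-concatMap g l f))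

  private
    2xy≤x²+y²-ordered : ∀ x y → x ≤ y → 2 * (x * y) ≤ x * x + y * y
    2xy≤x²+y²-ordered x y x≤y with m≤n⇒∃[o]m+o≡n x≤y
    ... | d , refl = ≤-trans (m≤m+n _ (d * d))
      (≤-reflexive (solve 2 (λ x d → con 2 :* (x :* (x :+ d)) :+ d :* d := x :* x :+ (x :+ d) :* (x :+ d)) refl x d))

  2xy≤x²+y² : ∀ x y → 2 * (x * y) ≤ x * x + y * y
  2xy≤x²+y² x y with ≤-total x y
  ... | inj₁ x≤y = 2xy≤x²+y²-ordered x y x≤y
  ... | inj₂ y≤x = subst₂ _≤_ (cong (2 *_) (*-comm y x)) (+-comm (y * y) (x * x)) (2xy≤x²+y²-ordered y x y≤x)

  module _ {A : Set} where

    ∑-product : ∀ (l : List A) (f g : A → ℕ) → ∑ l f * ∑ l g ≡ (∑[ i ∈ l ] ∑[ j ∈ l ] f i * g j)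
    ∑-product l f g = trans (sym (∑-*ʳ l (∑ l g) f)) (∑-cong l (λ i → sym (∑-*ˡ l (f i) g)))

    -- Symmetrise the double sum and apply 2xy ≤ x² + y² to x = aᵢbⱼ, y = aⱼbᵢ termwise.
    cauchy-schwarz : ∀ (l : List A) (a b : A → ℕ) →
      (∑[ i ∈ l ] a i * b i) * (∑[ i ∈ l ] a i * b i) ≤ (∑[ i ∈ l ] a i * a i) * (∑[ i ∈ l ] b i * b i)
    cauchy-schwarz l a b = *-cancelˡ-≤ 2 (begin
        2 * (∑ l ab * ∑ l ab)
          ≡⟨ cong (2 *_) (∑-product l ab ab) ⟩
        2 * (∑[ i ∈ l ] ∑[ j ∈ l ] ab i * ab j)
          ≡⟨ sym (trans (∑-cong l (λ i → ∑-*ˡ l 2 _)) (∑-*ˡ l 2 _)) ⟩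
        (∑[ i ∈ l ] ∑[ j ∈ l ] 2 * (ab i * ab j))
          ≤⟨ ∑-mono-≤ l (λ i → ∑-mono-≤ l (λ j → termwise i j)) ⟩
        (∑[ i ∈ l ] ∑[ j ∈ l ] aa i * bb j + aa j * bb i)
          ≡⟨ trans (∑-cong l (λ i → ∑-+ l _ _)) (∑-+ l _ _) ⟩
        (∑[ i ∈ l ] ∑[ j ∈ l ] aa i * bb j) + (∑[ i ∈ l ] ∑[ j ∈ l ] aa j * bb i)
          ≡⟨ cong (P +_) (∑-comm l l _) ⟩
        P + P
          ≡⟨ cong (λ t → t + t) (sym (∑-product l aa bb)) ⟩
        Q + Q
          ≡⟨ cong (Q +_) (sym (+-identityʳ Q)) ⟩
        2 * Q ∎)
      where
      open ≤-Reasoning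
      ab aa bb : A → ℕ
      ab i = a i * b i
      aa i = a i * a i
      bb i = b i * b i
      P = ∑[ i ∈ l ] ∑[ j ∈ l ] aa i * bb j
      Q = ∑ l aa * ∑ l bb
      termwise : ∀ i j → 2 * (ab i * ab j) ≤ aa i * bb j + aa j * bb i
      termwise i j = subst₂ (λ u v → 2 * u ≤ v)
        (solve 4 (λ p q r s → (p :* q) :* (r :* s) := (p :* s) :* (r :* q)) refl (a i) (b j) (a j) (b i))
        (solve 4 (λ p q r s → (p :* q) :* (p :* q) :+ (r :* s) :* (r :* s) := (p :* p) :* (q :* q) :+ (r :* r) :* (s :* s)) refl (a i) (b j) (a j) (b i))
        (2xy≤x²+y² (a i * b j) (a j * b i))

  module Kronecker {A : Set} (_≟_ : DecidableEquality A) where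

    δ : A → A → ℕ
    δ x y = 𝟙 (isYes (x ≟ y))

    δ-refl : ∀ x → δ x x ≡ 1
    δ-refl x with x ≟ x
    ... | yes _ = refl
    ... | no x≢x = contradiction refl x≢x

    δ-≢ : ∀ {x y} → x ≢ y → δ x y ≡ 0
    δ-≢ {x} {y} x≢y with x ≟ y
    ... | yes x≡y = contradiction x≡y x≢y
    ... | no _ = refl

    δ-sym : ∀ x y → δ x y ≡ δ y x
    δ-sym x y with x ≟ y
    ... | yes refl = sym (δ-refl x)
    ... | no x≢y = sym (δ-≢ (x≢y ∘ sym))

    δ-subst : ∀ x y (f : A → ℕ) → δ x y * f y ≡ δ x y * f x
    δ-subst x y f with x ≟ y
    ... | yes refl = refl
    ... | no _ = refl

  δ-injective : ∀ {A B : Set} (_≟ᴬ_ : DecidableEquality A) (_≟ᴮ_ : DecidableEquality B)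
    (f : A → B) → Injective _≡_ _≡_ f → ∀ x y → Kronecker.δ _≟ᴮ_ (f x) (f y) ≡ Kronecker.δ _≟ᴬ_ x y
  δ-injective _≟ᴬ_ _≟ᴮ_ f f-inj x y with x ≟ᴬ y
  ... | yes refl = Kronecker.δ-refl _≟ᴮ_ (f x)
  ... | no x≢y = Kronecker.δ-≢ _≟ᴮ_ (x≢y ∘ f-inj)

module FinSums where

  open import Data.Nat
  open import Data.Nat.Properties using (+-identityʳ; *-identityʳ; suc-injective)
  open import Data.List using (List; []; _∷_; map; length)
  open import Data.List.Membership.Propositional using (_∈_)
  open import Data.Fin using (Fin; zero; suc; toℕ)
  import Data.Fin.Properties as Fin
  open import Data.Vec using (toList; allFin)
  open import Data.Vec.Properties using (tabulate-allFin; toList-map; length-toList)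
  open import Data.Vec.Membership.Propositional.Properties using (∈-allFin⁺; ∈-toList⁺)
  open import Function using (_∘_)
  open import Relation.Binary.PropositionalEquality
  open Sums

  fins : (n : ℕ) → List (Fin n)
  fins n = toList (allFin n)

  ∈-fins : ∀ {n} (x : Fin n) → x ∈ fins n
  ∈-fins x = ∈-toList⁺ (∈-allFin⁺ x)

  length-fins : ∀ n → length (fins n) ≡ n
  length-fins n = length-toList (allFin n)

  ∑-fins-suc : ∀ n (f : Fin (suc n) → ℕ) → ∑ (fins (suc n)) f ≡ f zero + ∑ (fins n) (f ∘ suc)
  ∑-fins-suc n f = cong (f zero +_) (begin
      ∑ (toList (Data.Vec.tabulate suc)) f  ≡⟨ cong (λ l → ∑ l f) (trans (cong toList (tabulate-allFin suc)) (toList-map suc (allFin n))) ⟩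
      ∑ (map suc (fins n)) f               ≡⟨ ∑-map suc (fins n) f ⟩
      ∑ (fins n) (f ∘ suc)                 ∎)
    where open ≡-Reasoning

  module KroneckerFin {n : ℕ} = Kronecker (Fin._≟_ {n})
  open KroneckerFin public

  ∑-δ : ∀ {n} (x : Fin n) (f : Fin n → ℕ) → (∑[ z ∈ fins n ] δ x z * f z) ≡ f x
  ∑-δ {suc n} zero f = begin
      ∑[ z ∈ fins (suc n) ] δ zero z * f z        ≡⟨ ∑-fins-suc n (λ z → δ zero z * f z) ⟩
      f zero + 0 + (∑[ z ∈ fins n ] δ zero (suc z) * f (suc z))
        ≡⟨ cong₂ _+_ (+-identityʳ (f zero)) (∑-cong (fins n) (λ z → cong (_* f (suc z)) (δ-≢ {x = zero} {y = suc z} (λ ())))) ⟩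
      f zero + (∑[ z ∈ fins n ] 0 * f (suc z))    ≡⟨ cong (f zero +_) (∑-zero (fins n)) ⟩
      f zero + 0                                   ≡⟨ +-identityʳ (f zero) ⟩
      f zero                                       ∎
    where open ≡-Reasoning
  ∑-δ {suc n} (suc x) f = begin
      ∑[ z ∈ fins (suc n) ] δ (suc x) z * f z     ≡⟨ ∑-fins-suc n (λ z → δ (suc x) z * f z) ⟩
      δ (suc x) zero * f zero + (∑[ z ∈ fins n ] δ (suc x) (suc z) * f (suc z))
        ≡⟨ cong₂ _+_ (cong (_* f zero) (δ-≢ {x = suc x} {y = zero} (λ ())))
                     (∑-cong (fins n) (λ z → cong (_* f (suc z)) (δ-injective Fin._≟_ Fin._≟_ suc Fin.suc-injective x z))) ⟩
      ∑[ z ∈ fins n ] δ x z * f (suc z)            ≡⟨ ∑-δ x (f ∘ suc) ⟩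
      f (suc x)                                    ∎
    where open ≡-Reasoning

  ∑-δ≡1 : ∀ {n} (x : Fin n) → (∑[ z ∈ fins n ] δ x z) ≡ 1
  ∑-δ≡1 {n} x = trans (∑-cong (fins n) (λ z → sym (*-identityʳ (δ x z)))) (∑-δ x (λ _ → 1))

  range : ℕ → List ℕ
  range zero = []
  range (suc C) = zero ∷ map suc (range C)

  module Kroneckerℕ = Kronecker _≟_
  open Kroneckerℕ public using () renaming (δ to δℕ; δ-sym to δℕ-sym; δ-≢ to δℕ-≢)

  ∑-δℕ : ∀ C a (f : ℕ → ℕ) → a < C → (∑[ c ∈ range C ] δℕ a c * f c) ≡ f a
  ∑-δℕ (suc C) zero f _ = begin
      f zero + 0 + ∑ (map suc (range C)) (λ c → δℕ zero c * f c)
        ≡⟨ cong₂ _+_ (+-identityʳ (f zero)) (∑-map suc (range C) _) ⟩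
      f zero + (∑[ c ∈ range C ] δℕ zero (suc c) * f (suc c))
        ≡⟨ cong (f zero +_) (trans (∑-cong (range C) (λ c → cong (_* f (suc c)) (δℕ-≢ {x = zero} {y = suc c} (λ ())))) (∑-zero (range C))) ⟩
      f zero + 0                                   ≡⟨ +-identityʳ (f zero) ⟩
      f zero                                       ∎
    where open ≡-Reasoning
  ∑-δℕ (suc C) (suc a) f (s≤s a<C) = begin
      δℕ (suc a) zero * f zero + ∑ (map suc (range C)) (λ c → δℕ (suc a) c * f c)
        ≡⟨ cong₂ _+_ (cong (_* f zero) (δℕ-≢ {x = suc a} {y = zero} (λ ()))) (∑-map suc (range C) _) ⟩
      ∑[ c ∈ range C ] δℕ (suc a) (suc c) * f (suc c)
        ≡⟨ ∑-cong (range C) (λ c → cong (_* f (suc c)) (δ-injective _≟_ _≟_ suc suc-injective a c)) ⟩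
      ∑[ c ∈ range C ] δℕ a c * f (suc c)           ≡⟨ ∑-δℕ C a (f ∘ suc) a<C ⟩
      f (suc a)                                    ∎
    where open ≡-Reasoning

  δℕ-split : ∀ C a b → a < C → δℕ a b ≡ (∑[ c ∈ range C ] δℕ a c * δℕ b c)
  δℕ-split C a b a<C = sym (trans (∑-δℕ C a (δℕ b) a<C) (δℕ-sym b a))

  δℕ-toℕ : ∀ {n} (x y : Fin n) → δℕ (toℕ x) (toℕ y) ≡ δ x y
  δℕ-toℕ = δ-injective Fin._≟_ _≟_ toℕ Fin.toℕ-injective

module Coincidences where

  open import Data.Nat
  open import Data.Nat.Properties
  open import Data.List using (List; []; _∷_; map; _++_; length)
  open import Data.List.Properties using (length-++; length-map)
  open import Data.List.Membership.Propositional using (_∈_)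
  open import Data.List.Membership.Propositional.Properties using (∈-map⁻; ∈-++⁻)
  open import Data.List.Relation.Unary.Any using (here; there)
  open import Data.Bool using (Bool; true; false; _∧_; not)
  open import Data.Bool.ListAction using (any)
  open import Data.Bool.Properties using (not-involutive)
  open import Data.Product using (_×_; _,_; ∃₂)
  open import Data.Sum using (inj₁; inj₂)
  open import Relation.Binary.PropositionalEquality
  open import Relation.Nullary.Decidable using (⌊_⌋)
  open Sums
  open FinSums

  lookupOr : ∀ {X : Set} → X → List X → ℕ → X
  lookupOr d [] i = d
  lookupOr d (a ∷ l) zero = a
  lookupOr d (a ∷ l) (suc i) = lookupOr d l i

  coincidences : List ℕ → ℕ
  coincidences [] = 0
  coincidences (x ∷ xs) = (∑[ y ∈ xs ] δℕ x y) + coincidences xs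

  𝟙-not-∧ : ∀ a b → 𝟙 (not (a ∧ b)) ≤ 𝟙 (not a) + 𝟙 (not b)
  𝟙-not-∧ true b = ≤-refl
  𝟙-not-∧ false b = s≤s z≤n

  𝟙-any : ∀ {X : Set} (p : X → Bool) xs → 𝟙 (any p xs) ≤ (∑[ x ∈ xs ] 𝟙 (p x))
  𝟙-any p [] = z≤n
  𝟙-any p (x ∷ xs) with p x
  ... | true = s≤s z≤n
  ... | false = 𝟙-any p xs

  ¬distinct≤coincidences : ∀ xs → 𝟙 (not (distinctℕ xs)) ≤ coincidences xs
  ¬distinct≤coincidences [] = z≤n
  ¬distinct≤coincidences (x ∷ xs) = ≤-trans (𝟙-not-∧ (not (any (λ y → ⌊ x ≟ y ⌋) xs)) (distinctℕ xs))
    (+-mono-≤ (subst (λ b → 𝟙 b ≤ (∑[ y ∈ xs ] δℕ x y)) (sym (not-involutive _)) (𝟙-any (λ y → ⌊ x ≟ y ⌋) xs))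
              (¬distinct≤coincidences xs))

  positionPairs : ℕ → List (ℕ × ℕ)
  positionPairs zero = []
  positionPairs (suc L) = map (λ j → (0 , suc j)) (range L) ++ map (λ { (i , j) → (suc i , suc j) }) (positionPairs L)

  ∈-range⁻ : ∀ {L c} → c ∈ range L → c < L
  ∈-range⁻ {suc L} (here refl) = s≤s z≤n
  ∈-range⁻ {suc L} (there c∈) with ∈-map⁻ suc c∈
  ... | c , c∈L , refl = s≤s (∈-range⁻ c∈L)

  ∈-positionPairs⁻ : ∀ {L i j} → (i , j) ∈ positionPairs L → i < j × j < L
  ∈-positionPairs⁻ {suc L} p∈ with ∈-++⁻ (map (λ j → (0 , suc j)) (range L)) p∈
  ... | inj₁ q with ∈-map⁻ (λ j → (0 , suc j)) q
  ...   | j , j∈ , refl = s≤s z≤n , s≤s (∈-range⁻ j∈)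
  ∈-positionPairs⁻ {suc L} p∈ | inj₂ q with ∈-map⁻ (λ { (i , j) → (suc i , suc j) }) q
  ...   | (i , j) , p∈L , refl with ∈-positionPairs⁻ p∈L
  ...     | i<j , j<L = s≤s i<j , s≤s j<L

  ∈-positionPairs-shape : ∀ {m i j} → (i , j) ∈ positionPairs (suc m) → ∃₂ λ a b → j ≡ i + suc a × m ≡ i + suc (a + b)
  ∈-positionPairs-shape {m} {i} p∈ with ∈-positionPairs⁻ {suc m} p∈
  ... | i<j , j<sm with m≤n⇒∃[o]m+o≡n i<j | m≤n⇒∃[o]m+o≡n (≤-pred j<sm)
  ...   | a , refl | b , refl = a , b , sym (+-suc i a) , trans (+-assoc (suc i) a b) (sym (+-suc i (a + b)))

  length-range : ∀ L → length (range L) ≡ L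
  length-range zero = refl
  length-range (suc L) = cong suc (trans (length-map suc (range L)) (length-range L))

  length-positionPairs : ∀ L → length (positionPairs L) ≤ L * L
  length-positionPairs zero = z≤n
  length-positionPairs (suc L) = begin
      length (positionPairs (suc L))
        ≡⟨ trans (length-++ (map (λ j → (0 , suc j)) (range L))) (cong₂ _+_ (trans (length-map _ (range L)) (length-range L)) (length-map _ (positionPairs L))) ⟩
      L + length (positionPairs L)  ≤⟨ +-monoʳ-≤ L (length-positionPairs L) ⟩
      L + L * L                     ≤⟨ m≤n+m (L + L * L) (suc L) ⟩
      suc L + (L + L * L)           ≡⟨ cong (suc L +_) (sym (*-suc L L)) ⟩
      suc L * suc L                 ∎
    where open ≤-Reasoning

  ∑-lookupOr : ∀ {X : Set} (d : X) (E : List X) (f : X → ℕ) → ∑ E f ≡ (∑[ j ∈ range (length E) ] f (lookupOr d E j))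
  ∑-lookupOr d [] f = refl
  ∑-lookupOr d (e ∷ E) f = cong (f e +_) (trans (∑-lookupOr d E f) (sym (∑-map suc (range (length E)) (λ j → f (lookupOr d (e ∷ E) j)))))

  coincidences-map : ∀ {X : Set} (d : X) (h : X → ℕ) (E : List X) →
    coincidences (map h E) ≡ (∑[ (i , j) ∈ positionPairs (length E) ] δℕ (h (lookupOr d E i)) (h (lookupOr d E j)))
  coincidences-map d h [] = refl
  coincidences-map d h (e ∷ E) = begin
      (∑[ y ∈ map h E ] δℕ (h e) y) + coincidences (map h E)
        ≡⟨ cong₂ _+_ (trans (∑-map h E (δℕ (h e))) (∑-lookupOr d E (λ z → δℕ (h e) (h z)))) (coincidences-map d h E) ⟩
      (∑[ j ∈ range (length E) ] F (0 , suc j)) + (∑[ (i , j) ∈ positionPairs (length E) ] F (suc i , suc j))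
        ≡⟨ sym (cong₂ _+_ (∑-map (λ j → (0 , suc j)) (range (length E)) F) (∑-map (λ { (i , j) → (suc i , suc j) }) (positionPairs (length E)) F)) ⟩
      ∑ (map (λ j → (0 , suc j)) (range (length E))) F + ∑ (map (λ { (i , j) → (suc i , suc j) }) (positionPairs (length E))) F
        ≡⟨ sym (∑-++ (map (λ j → (0 , suc j)) (range (length E))) _ F) ⟩
      ∑ (positionPairs (length (e ∷ E))) F ∎
    where
    open ≡-Reasoning
    F : ℕ × ℕ → ℕ
    F (i , j) = δℕ (h (lookupOr d (e ∷ E) i)) (h (lookupOr d (e ∷ E) j))

module Matrices (n : ℕ) where

  open import Data.Nat
  open import Data.Nat.Properties
  open import Data.List using (List; []; _∷_; map; _++_; concatMap; reverse; [_])
  open import Data.List.Properties using (unfold-reverse)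
  open import Data.List.Relation.Unary.All using (All; []; _∷_)
  open import Data.Fin using (Fin)
  open import Data.Product using (_×_; _,_)
  open import Data.Unit using (tt)
  open import Relation.Binary.PropositionalEquality hiding ([_])
  open Sums
  open FinSums

  Mat : Set
  Mat = Fin n → Fin n → ℕ

  V : List (Fin n)
  V = fins n

  infixl 7 _·_
  _·_ : Mat → Mat → Mat
  (X · Y) x y = ∑[ z ∈ V ] X x z * Y z y

  I : Mat
  I = δ

  infix 4 _≈_
  _≈_ : Mat → Mat → Set
  X ≈ Y = ∀ x y → X x y ≡ Y x y

  ≈-refl : ∀ {X} → X ≈ X
  ≈-refl x y = refl

  ≈-sym : ∀ {X Y} → X ≈ Y → Y ≈ X
  ≈-sym e x y = sym (e x y)

  ≈-trans : ∀ {X Y Z} → X ≈ Y → Y ≈ Z → X ≈ Z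
  ≈-trans e f x y = trans (e x y) (f x y)

  ·-cong : ∀ {X X′ Y Y′} → X ≈ X′ → Y ≈ Y′ → X · Y ≈ X′ · Y′
  ·-cong e f x y = ∑-cong V (λ z → cong₂ _*_ (e x z) (f z y))

  ·-assoc : ∀ X Y Z → (X · Y) · Z ≈ X · (Y · Z)
  ·-assoc X Y Z x y = begin
      ∑[ w ∈ V ] (∑[ z ∈ V ] X x z * Y z w) * Z w y
        ≡⟨ ∑-cong V (λ w → sym (∑-*ʳ V (Z w y) (λ z → X x z * Y z w))) ⟩
      ∑[ w ∈ V ] ∑[ z ∈ V ] X x z * Y z w * Z w y
        ≡⟨ ∑-comm V V _ ⟩
      ∑[ z ∈ V ] ∑[ w ∈ V ] X x z * Y z w * Z w y
        ≡⟨ ∑-cong V (λ z → trans (∑-cong V (λ w → *-assoc (X x z) (Y z w) (Z w y))) (∑-*ˡ V (X x z) _)) ⟩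
      ∑[ z ∈ V ] X x z * (∑[ w ∈ V ] Y z w * Z w y) ∎
    where open ≡-Reasoning

  ·-identityˡ : ∀ X → I · X ≈ X
  ·-identityˡ X x y = ∑-δ x (λ z → X z y)

  ·-identityʳ : ∀ X → X · I ≈ X
  ·-identityʳ X x y = trans (∑-cong V (λ z → trans (*-comm (X x z) (δ z y)) (cong (_* X x z) (δ-sym z y)))) (∑-δ y (X x))

  ∏ : List Mat → Mat
  ∏ [] = I
  ∏ (X ∷ Xs) = X · ∏ Xs

  ∏-++ : ∀ Xs Ys → ∏ (Xs ++ Ys) ≈ ∏ Xs · ∏ Ys
  ∏-++ [] Ys = ≈-sym (·-identityˡ (∏ Ys))
  ∏-++ (X ∷ Xs) Ys = ≈-trans (·-cong (≈-refl {X}) (∏-++ Xs Ys)) (≈-sym (·-assoc X (∏ Xs) (∏ Ys)))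

  ∏-[_] : ∀ X → ∏ [ X ] ≈ X
  ∏-[ X ] = ·-identityʳ X

  ∏-replace : ∀ Xs {M M′} Ys → M ≈ M′ → ∏ (Xs ++ M ∷ Ys) ≈ ∏ (Xs ++ M′ ∷ Ys)
  ∏-replace [] Ys e = ·-cong e ≈-refl
  ∏-replace (Z ∷ Xs) Ys e = ·-cong (≈-refl {Z}) (∏-replace Xs Ys e)

  ∏-expand : ∀ Xs X Y Ys → ∏ (Xs ++ X · Y ∷ Ys) ≈ ∏ (Xs ++ X ∷ Y ∷ Ys)
  ∏-expand [] X Y Ys = ·-assoc X Y (∏ Ys)
  ∏-expand (Z ∷ Xs) X Y Ys = ·-cong (≈-refl {Z}) (∏-expand Xs X Y Ys)

  infixl 8 _⊙_
  _⊙_ : Mat → Mat → Mat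
  (X ⊙ Y) x y = X x y * Y x y

  tr : Mat → ℕ
  tr X = ∑[ x ∈ V ] X x x

  tr-cong : ∀ {X Y} → X ≈ Y → tr X ≡ tr Y
  tr-cong e = ∑-cong V (λ x → e x x)

  tr-comm : ∀ X Y → tr (X · Y) ≡ tr (Y · X)
  tr-comm X Y = trans (∑-comm V V _) (∑-cong V (λ z → ∑-cong V (λ x → *-comm (X x z) (Y z x))))

  tr-∏-rotate : ∀ Xs Ys → tr (∏ (Xs ++ Ys)) ≡ tr (∏ (Ys ++ Xs))
  tr-∏-rotate Xs Ys = trans (tr-cong (∏-++ Xs Ys)) (trans (tr-comm (∏ Xs) (∏ Ys)) (sym (tr-cong (∏-++ Ys Xs))))

  _ᵀ : Mat → Mat
  (X ᵀ) x y = X y x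

  Symmetric : Mat → Set
  Symmetric X = ∀ x y → X x y ≡ X y x

  ·-ᵀ : ∀ X Y → (X · Y) ᵀ ≈ Y ᵀ · X ᵀ
  ·-ᵀ X Y x y = ∑-cong V (λ z → *-comm (X y z) (Y z x))

  ∏-ᵀ : ∀ Xs → All Symmetric Xs → (∏ Xs) ᵀ ≈ ∏ (reverse Xs)
  ∏-ᵀ [] [] x y = δ-sym y x
  ∏-ᵀ (X ∷ Xs) (X-sym ∷ Xs-sym) = ≈-trans (·-ᵀ X (∏ Xs))
    (≈-trans (·-cong (∏-ᵀ Xs Xs-sym) (λ x y → trans (X-sym y x) (sym (∏-[ X ] x y))))
    (≈-trans (≈-sym (∏-++ (reverse Xs) [ X ])) (λ x y → cong (λ l → ∏ l x y) (sym (unfold-reverse X Xs)))))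

  ⟨_,_⟩ : Mat → Mat → ℕ
  ⟨ X , Y ⟩ = ∑[ x ∈ V ] ∑[ y ∈ V ] X x y * Y x y

  ⟨,⟩-tr : ∀ X Y → ⟨ X , Y ⟩ ≡ tr (X ᵀ · Y)
  ⟨,⟩-tr X Y = ∑-comm V V _

  module _ {C : Set} where

    private
      entries : List C → List (C × Fin n × Fin n)
      entries cs = concatMap (λ c → concatMap (λ x → map (λ y → (c , x , y)) V) V) cs

      ∑-entries : ∀ cs (f : C × Fin n × Fin n → ℕ) → ∑ (entries cs) f ≡ (∑[ c ∈ cs ] ∑[ x ∈ V ] ∑[ y ∈ V ] f (c , x , y))
      ∑-entries cs f = trans (∑-concatMap _ cs f) (∑-cong cs (λ c → trans (∑-concatMap _ V f) (∑-cong V (λ x → ∑-map _ V f))))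

    ∑⟨,⟩-cauchy-schwarz : ∀ (cs : List C) (X Y : C → Mat) →
      (∑[ c ∈ cs ] ⟨ X c , Y c ⟩) * (∑[ c ∈ cs ] ⟨ X c , Y c ⟩) ≤ (∑[ c ∈ cs ] ⟨ X c , X c ⟩) * (∑[ c ∈ cs ] ⟨ Y c , Y c ⟩)
    ∑⟨,⟩-cauchy-schwarz cs X Y = subst₂ _≤_ (cong₂ _*_ (∑-entries cs _) (∑-entries cs _)) (cong₂ _*_ (∑-entries cs _) (∑-entries cs _))
      (cauchy-schwarz (entries cs) (λ { (c , x , y) → X c x y }) (λ { (c , x , y) → Y c x y }))

  ⟨,⟩-cauchy-schwarz : ∀ X Y → ⟨ X , Y ⟩ * ⟨ X , Y ⟩ ≤ ⟨ X , X ⟩ * ⟨ Y , Y ⟩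
  ⟨,⟩-cauchy-schwarz X Y = subst₂ _≤_ (cong₂ _*_ (+-identityʳ ⟨ X , Y ⟩) (+-identityʳ ⟨ X , Y ⟩))
    (cong₂ _*_ (+-identityʳ ⟨ X , X ⟩) (+-identityʳ ⟨ Y , Y ⟩))
    (∑⟨,⟩-cauchy-schwarz [ tt ] (λ _ → X) (λ _ → Y))

module Walks (n : ℕ) where

  open import Data.Nat
  open import Data.Nat.Properties
  open import Data.List using (List; []; _∷_; _++_; length; zip; [_])
  open import Data.Bool using (Bool; true; false)
  open import Data.Fin using (Fin)
  open import Data.Vec using (Vec; []; _∷_; toList)
  open import Data.Product using (_×_; uncurry)
  open import Relation.Binary.PropositionalEquality hiding ([_])
  open import Algebra.Properties.CommutativeSemigroup *-commutativeSemigroup using (x∙yz≈y∙xz)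
  open Sums
  open FinSums
  open Matrices n
  open Coincidences using (lookupOr)

  ∑ᵛ : (m : ℕ) → (Vec (Fin n) m → ℕ) → ℕ
  ∑ᵛ zero f = f []
  ∑ᵛ (suc m) f = ∑[ i ∈ V ] ∑ᵛ m (λ w → f (i ∷ w))

  ∑ᵛ-cong : ∀ m {f g : Vec (Fin n) m → ℕ} → (∀ w → f w ≡ g w) → ∑ᵛ m f ≡ ∑ᵛ m g
  ∑ᵛ-cong zero e = e []
  ∑ᵛ-cong (suc m) e = ∑-cong V (λ i → ∑ᵛ-cong m (λ w → e (i ∷ w)))

  ∑ᵛ-mono-≤ : ∀ m {f g : Vec (Fin n) m → ℕ} → (∀ w → f w ≤ g w) → ∑ᵛ m f ≤ ∑ᵛ m g
  ∑ᵛ-mono-≤ zero e = e []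
  ∑ᵛ-mono-≤ (suc m) e = ∑-mono-≤ V (λ i → ∑ᵛ-mono-≤ m (λ w → e (i ∷ w)))

  ∑ᵛ-*ˡ : ∀ m a (f : Vec (Fin n) m → ℕ) → ∑ᵛ m (λ w → a * f w) ≡ a * ∑ᵛ m f
  ∑ᵛ-*ˡ zero a f = refl
  ∑ᵛ-*ˡ (suc m) a f = trans (∑-cong V (λ i → ∑ᵛ-*ˡ m a (λ w → f (i ∷ w)))) (∑-*ˡ V a _)

  ∑ᵛ-+ : ∀ m (f g : Vec (Fin n) m → ℕ) → ∑ᵛ m (λ w → f w + g w) ≡ ∑ᵛ m f + ∑ᵛ m g
  ∑ᵛ-+ zero f g = refl
  ∑ᵛ-+ (suc m) f g = trans (∑-cong V (λ i → ∑ᵛ-+ m (λ w → f (i ∷ w)) (λ w → g (i ∷ w)))) (∑-+ V _ _)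

  ∑ᵛ-∑ : ∀ {I : Set} m (l : List I) (f : I → Vec (Fin n) m → ℕ) → ∑ᵛ m (λ w → ∑[ c ∈ l ] f c w) ≡ (∑[ c ∈ l ] ∑ᵛ m (f c))
  ∑ᵛ-∑ zero l f = refl
  ∑ᵛ-∑ (suc m) l f = trans (∑-cong V (λ i → ∑ᵛ-∑ m l (λ c w → f c (i ∷ w)))) (∑-comm V l _)

  countVec≡∑ᵛ : ∀ m (P : Vec (Fin n) m → Bool) → countVec n m P ≡ ∑ᵛ m (λ w → 𝟙 (P w))
  countVec≡∑ᵛ zero P with P []
  ... | true = refl
  ... | false = refl
  countVec≡∑ᵛ (suc m) P = ∑-cong V (λ i → countVec≡∑ᵛ m (λ w → P (i ∷ w)))

  -- weight [M₀, …, Mₖ] x [z₁, …, zₖ] y = M₀ x z₁ · M₁ z₁ z₂ ⋯ Mₖ zₖ y, and 0 on a length mismatch.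
  weight : List Mat → Fin n → List (Fin n) → Fin n → ℕ
  weight Ms x [] y = sole Ms x y
    where
    sole : List Mat → Mat
    sole (M ∷ []) = M
    sole _ _ _ = 0
  weight [] x (z ∷ l) y = 0
  weight (M ∷ Ms) x (z ∷ l) y = M x z * weight Ms z l y

  ∑ᵛ-weight : ∀ m (Ms : List Mat) x y → length Ms ≡ suc m → ∑ᵛ m (λ w → weight Ms x (toList w) y) ≡ ∏ Ms x y
  ∑ᵛ-weight zero (M ∷ []) x y _ = sym (∏-[ M ] x y)
  ∑ᵛ-weight (suc m) (M ∷ Ms) x y len = ∑-cong V (λ z →
    trans (∑ᵛ-*ˡ m (M x z) (λ w → weight Ms z (toList w) y)) (cong (M x z *_) (∑ᵛ-weight m Ms z y (suc-injective len))))

  edges : Fin n → List (Fin n) → Fin n → List (Fin n × Fin n)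
  edges x l y = zip (x ∷ l) (l ++ [ y ])

  weight-⊙ : ∀ (Xs Ys : List Mat) H B x l y d → length Xs ≤ length l →
    weight (Xs ++ H ⊙ B ∷ Ys) x l y ≡ uncurry H (lookupOr d (edges x l y) (length Xs)) * weight (Xs ++ B ∷ Ys) x l y
  weight-⊙ [] [] H B x [] y d _ = refl
  weight-⊙ [] (_ ∷ _) H B x [] y d _ = sym (*-zeroʳ (H x y))
  weight-⊙ [] Ys H B x (z ∷ l) y d _ = *-assoc (H x z) (B x z) (weight Ys z l y)
  weight-⊙ (X ∷ Xs) Ys H B x (z ∷ l) y d (s≤s len) = trans (cong (X x z *_) (weight-⊙ Xs Ys H B z l y d len))
    (x∙yz≈y∙xz (X x z) (uncurry H (lookupOr d (edges z l y) (length Xs))) (weight (Xs ++ B ∷ Ys) z l y))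

module Maxima where

  open import Data.Nat
  open import Data.Nat.Properties
  open import Data.Product using (_×_; _,_; ∃-syntax)
  open import Data.Sum using ([_,_]′)
  open import Relation.Binary.PropositionalEquality
  open import Relation.Nullary using (yes; no)

  maximiser : (f : ℕ → ℕ) (N : ℕ) → ∃[ q ] q ≤ N × (∀ p → p ≤ N → f p ≤ f q)
  maximiser f zero = 0 , z≤n , λ { .0 z≤n → ≤-refl }
  maximiser f (suc N) with maximiser f N
  ... | q , q≤N , max with f q ≤? f (suc N)
  ...   | yes fq≤ = suc N , ≤-refl , λ p p≤ →
          [ (λ p<sN → ≤-trans (max p (≤-pred p<sN)) fq≤) , (λ { refl → ≤-refl }) ]′ (m≤n⇒m<n∨m≡n p≤)
  ...   | no fq≰ = q , m≤n⇒m≤1+n q≤N , λ p p≤ →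
          [ (λ p<sN → max p (≤-pred p<sN)) , (λ { refl → <⇒≤ (≰⇒> fq≰) }) ]′ (m≤n⇒m<n∨m≡n p≤)

  -- By symmetry some maximiser r lies in [0, K]; then f r ² ≤ f 0 · f (2r) ≤ f 0 · f r.
  maximum-at-0 : (f : ℕ → ℕ) (K : ℕ) →
    (∀ p → p ≤ K + K → f p ≡ f (K + K ∸ p)) →
    (∀ p → p ≤ K → f p * f p ≤ f 0 * f (p + p)) →
    ∀ p → p ≤ K + K → f p ≤ f 0
  maximum-at-0 f K f-sym f-cs p p≤ with maximiser f (K + K)
  ... | q , q≤ , max = ≤-trans (max p p≤) (maximum-bound mirrored)
    where
    bound : ∀ r → r ≤ K → f (r + r) ≤ f r → f r ≤ f 0
    bound r r≤K f2r≤fr with f r in fr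
    ... | zero = z≤n
    ... | suc m = *-cancelʳ-≤ (suc m) (f 0) (suc m) (begin
          suc m * suc m     ≡⟨ cong (λ t → t * t) (sym fr) ⟩
          f r * f r         ≤⟨ f-cs r r≤K ⟩
          f 0 * f (r + r)   ≤⟨ *-monoʳ-≤ (f 0) f2r≤fr ⟩
          f 0 * suc m       ∎)
      where open ≤-Reasoning

    mirrored : ∃[ r ] r ≤ K × f r ≡ f q
    mirrored with q ≤? K
    ... | yes q≤K = q , q≤K , refl
    ... | no q≰K = K + K ∸ q , m≤n+o⇒m∸n≤o (K + K) q (+-monoˡ-≤ K (<⇒≤ (≰⇒> q≰K))) , sym (f-sym q q≤)

    maximum-bound : (∃[ r ] r ≤ K × f r ≡ f q) → f q ≤ f 0
    maximum-bound (r , r≤K , fr≡fq) = subst (_≤ f 0) fr≡fq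
      (bound r r≤K (subst (f (r + r) ≤_) (sym fr≡fq) (max (r + r) (+-mono-≤ r≤K r≤K))))

module Powers (n : ℕ) (A : Matrices.Mat n) (A-sym : Matrices.Symmetric n A) where

  open import Data.Nat
  open import Data.Nat.Properties
  open import Data.Nat.Solver using (module +-*-Solver)
  open import Data.List using (List; []; _∷_; _++_; reverse; replicate; [_]; length)
  open import Data.List.Properties using (++-assoc; reverse-++; unfold-reverse; length-++; length-replicate)
  open import Data.List.Relation.Unary.All using (All; []; _∷_)
  open import Data.Product using (_,_; uncurry)
  open import Relation.Binary.PropositionalEquality hiding ([_])
  open +-*-Solver using (solve; _:=_; _:+_; _:*_; con)
  open Sums
  open FinSums
  open Matrices n
  open Walks n
  open Coincidences using (lookupOr)
  open Maxima

  A^ : ℕ → List Mat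
  A^ p = replicate p A

  A^-+ : ∀ a b → A^ a ++ A^ b ≡ A^ (a + b)
  A^-+ zero b = refl
  A^-+ (suc a) b = cong (A ∷_) (A^-+ a b)

  A^-∷ʳ : ∀ a → A^ a ++ [ A ] ≡ A ∷ A^ a
  A^-∷ʳ zero = refl
  A^-∷ʳ (suc a) = cong (A ∷_) (A^-∷ʳ a)

  reverse-A^ : ∀ a → reverse (A^ a) ≡ A^ a
  reverse-A^ zero = refl
  reverse-A^ (suc a) = trans (unfold-reverse A (A^ a)) (trans (cong (_++ [ A ]) (reverse-A^ a)) (A^-∷ʳ a))

  All-symmetric-A^ : ∀ a → All Symmetric (A^ a)
  All-symmetric-A^ zero = []
  All-symmetric-A^ (suc a) = A-sym ∷ All-symmetric-A^ a

  private
    All-++ : ∀ {Xs Ys : List Mat} → All Symmetric Xs → All Symmetric Ys → All Symmetric (Xs ++ Ys)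
    All-++ [] h = h
    All-++ (p ∷ g) h = p ∷ All-++ g h

  closedWalks : ℕ → ℕ
  closedWalks j = tr (∏ (A^ j))

  ⟨A^,A^⟩ : ∀ a b → ⟨ ∏ (A^ a) , ∏ (A^ b) ⟩ ≡ closedWalks (a + b)
  ⟨A^,A^⟩ a b = begin
      ⟨ ∏ (A^ a) , ∏ (A^ b) ⟩          ≡⟨ ⟨,⟩-tr (∏ (A^ a)) (∏ (A^ b)) ⟩
      tr (∏ (A^ a) ᵀ · ∏ (A^ b))        ≡⟨ tr-cong (·-cong (∏-ᵀ (A^ a) (All-symmetric-A^ a)) ≈-refl) ⟩
      tr (∏ (reverse (A^ a)) · ∏ (A^ b)) ≡⟨ cong (λ l → tr (∏ l · ∏ (A^ b))) (reverse-A^ a) ⟩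
      tr (∏ (A^ a) · ∏ (A^ b))          ≡⟨ sym (tr-cong (∏-++ (A^ a) (A^ b))) ⟩
      tr (∏ (A^ a ++ A^ b))             ≡⟨ cong (λ l → tr (∏ l)) (A^-+ a b) ⟩
      closedWalks (a + b)               ∎
    where open ≡-Reasoning

  markedTrace : Mat → ℕ → ℕ → ℕ
  markedTrace M p q = tr (∏ ((M ∷ A^ p) ++ (M ∷ A^ q)))

  markedTrace-sym : ∀ M p q → markedTrace M p q ≡ markedTrace M q p
  markedTrace-sym M p q = tr-∏-rotate (M ∷ A^ p) (M ∷ A^ q)

  -- ⟨A^s M A^t, A^p M A^q⟩ = tr(A^t M A^s A^p M A^q) is a marked trace: this is where Cauchy–Schwarz enters.
  ⟨split,split⟩ : ∀ M → Symmetric M → ∀ s t p q →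
    ⟨ ∏ (A^ s ++ M ∷ A^ t) , ∏ (A^ p ++ M ∷ A^ q) ⟩ ≡ markedTrace M (s + p) (q + t)
  ⟨split,split⟩ M M-sym s t p q = begin
      ⟨ ∏ (A^ s ++ M ∷ A^ t) , ∏ (A^ p ++ M ∷ A^ q) ⟩
        ≡⟨ ⟨,⟩-tr (∏ (A^ s ++ M ∷ A^ t)) _ ⟩
      tr (∏ (A^ s ++ M ∷ A^ t) ᵀ · ∏ (A^ p ++ M ∷ A^ q))
        ≡⟨ tr-cong (·-cong (∏-ᵀ (A^ s ++ M ∷ A^ t) (All-++ (All-symmetric-A^ s) (M-sym ∷ All-symmetric-A^ t))) ≈-refl) ⟩
      tr (∏ (reverse (A^ s ++ M ∷ A^ t)) · ∏ (A^ p ++ M ∷ A^ q))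
        ≡⟨ cong (λ l → tr (∏ l · ∏ (A^ p ++ M ∷ A^ q))) reverse-split ⟩
      tr (∏ (A^ t ++ M ∷ A^ s) · ∏ (A^ p ++ M ∷ A^ q))
        ≡⟨ sym (tr-cong (∏-++ (A^ t ++ M ∷ A^ s) (A^ p ++ M ∷ A^ q))) ⟩
      tr (∏ ((A^ t ++ M ∷ A^ s) ++ (A^ p ++ M ∷ A^ q)))
        ≡⟨ cong (λ l → tr (∏ l)) (++-assoc (A^ t) (M ∷ A^ s) _) ⟩
      tr (∏ (A^ t ++ ((M ∷ A^ s) ++ (A^ p ++ M ∷ A^ q))))
        ≡⟨ tr-∏-rotate (A^ t) _ ⟩
      tr (∏ (((M ∷ A^ s) ++ (A^ p ++ M ∷ A^ q)) ++ A^ t))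
        ≡⟨ cong (λ l → tr (∏ l)) regroup ⟩
      markedTrace M (s + p) (q + t) ∎
    where
    open ≡-Reasoning
    reverse-split : reverse (A^ s ++ M ∷ A^ t) ≡ A^ t ++ M ∷ A^ s
    reverse-split = begin
        reverse (A^ s ++ M ∷ A^ t)            ≡⟨ reverse-++ (A^ s) (M ∷ A^ t) ⟩
        reverse (M ∷ A^ t) ++ reverse (A^ s)  ≡⟨ cong₂ _++_ (trans (unfold-reverse M (A^ t)) (cong (_++ [ M ]) (reverse-A^ t))) (reverse-A^ s) ⟩
        (A^ t ++ [ M ]) ++ A^ s               ≡⟨ ++-assoc (A^ t) [ M ] (A^ s) ⟩
        A^ t ++ M ∷ A^ s                      ∎
    regroup : ((M ∷ A^ s) ++ (A^ p ++ M ∷ A^ q)) ++ A^ t ≡ (M ∷ A^ (s + p)) ++ (M ∷ A^ (q + t))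
    regroup = begin
        ((M ∷ A^ s) ++ (A^ p ++ M ∷ A^ q)) ++ A^ t   ≡⟨ ++-assoc (M ∷ A^ s) (A^ p ++ M ∷ A^ q) (A^ t) ⟩
        M ∷ (A^ s ++ ((A^ p ++ M ∷ A^ q) ++ A^ t))   ≡⟨ cong (λ l → M ∷ (A^ s ++ l)) (++-assoc (A^ p) (M ∷ A^ q) (A^ t)) ⟩
        M ∷ (A^ s ++ (A^ p ++ M ∷ (A^ q ++ A^ t)))   ≡⟨ cong (M ∷_) (sym (++-assoc (A^ s) (A^ p) _)) ⟩
        M ∷ ((A^ s ++ A^ p) ++ M ∷ (A^ q ++ A^ t))   ≡⟨ cong₂ (λ a b → M ∷ (a ++ M ∷ b)) (A^-+ s p) (A^-+ q t) ⟩
        (M ∷ A^ (s + p)) ++ (M ∷ A^ (q + t))         ∎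

  module MarkedFamily (cs : List ℕ) (M : ℕ → Mat) (M-sym : ∀ c → Symmetric (M c)) where

    Φ : ℕ → ℕ → ℕ
    Φ p q = ∑[ c ∈ cs ] markedTrace (M c) p q

    Φ-sym : ∀ p q → Φ p q ≡ Φ q p
    Φ-sym p q = ∑-cong cs (λ c → markedTrace-sym (M c) p q)

    Φ-cauchy-schwarz : ∀ s p t q → Φ (s + p) (q + t) * Φ (s + p) (q + t) ≤ Φ (s + s) (t + t) * Φ (p + p) (q + q)
    Φ-cauchy-schwarz s p t q = subst₂ _≤_
      (cong₂ _*_ (split-sum s t p q) (split-sum s t p q)) (cong₂ _*_ (split-sum s t s t) (split-sum p q p q))
      (∑⟨,⟩-cauchy-schwarz cs (λ c → ∏ (A^ s ++ M c ∷ A^ t)) (λ c → ∏ (A^ p ++ M c ∷ A^ q)))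
      where
      split-sum : ∀ s t p q → (∑[ c ∈ cs ] ⟨ ∏ (A^ s ++ M c ∷ A^ t) , ∏ (A^ p ++ M c ∷ A^ q) ⟩) ≡ Φ (s + p) (q + t)
      split-sum s t p q = ∑-cong cs (λ c → ⟨split,split⟩ (M c) (M-sym c) s t p q)

    Φ-maximum : ∀ σ K a b → a + b ≡ K + K → Φ (σ + σ + a) (σ + σ + b) ≤ Φ (σ + σ) (σ + σ + (K + K))
    Φ-maximum σ K a b a+b≡ = subst₂ _≤_ fa≡ (cong (λ t → Φ t (σ + σ + (K + K))) (+-identityʳ (σ + σ)))
      (maximum-at-0 f K f-sym f-cs a a≤)
      where
      f : ℕ → ℕ
      f p = Φ (σ + σ + p) (σ + σ + (K + K ∸ p))
      a≤ : a ≤ K + K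
      a≤ = subst (a ≤_) a+b≡ (m≤m+n a b)
      fa≡ : f a ≡ Φ (σ + σ + a) (σ + σ + b)
      fa≡ = cong (λ t → Φ (σ + σ + a) (σ + σ + t)) (trans (cong (_∸ a) (sym a+b≡)) (m+n∸m≡n a b))
      f-sym : ∀ p → p ≤ K + K → f p ≡ f (K + K ∸ p)
      f-sym p p≤ = trans (Φ-sym (σ + σ + p) (σ + σ + (K + K ∸ p))) (cong (λ t → Φ (σ + σ + (K + K ∸ p)) (σ + σ + t)) (sym (m∸[m∸n]≡n p≤)))
      f-cs : ∀ p → p ≤ K → f p * f p ≤ f 0 * f (p + p)
      f-cs p p≤K with m≤n⇒∃[o]m+o≡n p≤K
      ... | r , refl = subst₂ _≤_ (cong (λ t → t * t) (cong₂ Φ e₁ e₂)) (cong₂ _*_ (cong₂ Φ e₃ e₄) (cong₂ Φ e₅ e₆))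
          (Φ-cauchy-schwarz σ (σ + p) (σ + (p + r)) (σ + r))
        where
        e₁ : σ + (σ + p) ≡ σ + σ + p
        e₁ = sym (+-assoc σ σ p)
        e₂ : σ + r + (σ + (p + r)) ≡ σ + σ + ((p + r) + (p + r) ∸ p)
        e₂ = trans (solve 3 (λ σ p r → σ :+ r :+ (σ :+ (p :+ r)) := σ :+ σ :+ (r :+ (p :+ r))) refl σ p r)
                   (cong (σ + σ +_) (sym (trans (cong (_∸ p) (+-assoc p r (p + r))) (m+n∸m≡n p (r + (p + r))))))
        e₃ : σ + σ ≡ σ + σ + 0
        e₃ = sym (+-identityʳ (σ + σ))
        e₄ : σ + (p + r) + (σ + (p + r)) ≡ σ + σ + ((p + r) + (p + r) ∸ 0)
        e₄ = solve 3 (λ σ p r → σ :+ (p :+ r) :+ (σ :+ (p :+ r)) := σ :+ σ :+ ((p :+ r) :+ (p :+ r))) refl σ p r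
        e₅ : σ + p + (σ + p) ≡ σ + σ + (p + p)
        e₅ = solve 2 (λ σ p → σ :+ p :+ (σ :+ p) := σ :+ σ :+ (p :+ p)) refl σ p
        e₆ : σ + r + (σ + r) ≡ σ + σ + ((p + r) + (p + r) ∸ (p + p))
        e₆ = trans (solve 2 (λ σ r → σ :+ r :+ (σ :+ r) := σ :+ σ :+ (r :+ r)) refl σ r)
                   (cong (σ + σ +_) (sym (trans (cong (_∸ (p + p)) (solve 2 (λ p r → (p :+ r) :+ (p :+ r) := (p :+ p) :+ (r :+ r)) refl p r)) (m+n∸m≡n (p + p) (r + r)))))

  closedWalks-log-convex : ∀ i → closedWalks (suc i + suc i) * closedWalks (suc i + suc i)
                                 ≤ closedWalks (i + i) * closedWalks (suc (suc i) + suc (suc i))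
  closedWalks-log-convex i = subst₂ _≤_
    (cong (λ t → t * t) (trans (⟨A^,A^⟩ i (suc (suc i))) (cong closedWalks (+-suc i (suc i)))))
    (cong₂ _*_ (⟨A^,A^⟩ i i) (⟨A^,A^⟩ (suc (suc i)) (suc (suc i))))
    (⟨,⟩-cauchy-schwarz (∏ (A^ i)) (∏ (A^ (suc (suc i)))))

  private
    ^-distribʳ-* : ∀ a b k → (a * b) ^ k ≡ a ^ k * b ^ k
    ^-distribʳ-* a b zero = refl
    ^-distribʳ-* a b (suc k) = trans (cong (a * b *_) (^-distribʳ-* a b k))
      (solve 4 (λ a b x y → a :* b :* (x :* y) := a :* x :* (b :* y)) refl a b (a ^ k) (b ^ k))

  closedWalks-power-bound : ∀ i → closedWalks (i + i) ^ suc i ≤ closedWalks 0 * closedWalks (suc i + suc i) ^ i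
  closedWalks-power-bound zero = ≤-refl
  closedWalks-power-bound (suc i) with closedWalks (suc i + suc i) in h₁≡
  ... | zero = z≤n
  ... | suc b-1 = *-cancelˡ-≤ (b ^ i) {{m^n≢0 b i}} (begin
        b ^ i * (b * (b * b ^ i))
          ≡⟨ solve 2 (λ b p → p :* (b :* (b :* p)) := (b :* p) :* (b :* p)) refl b (b ^ i) ⟩
        b ^ suc i * b ^ suc i
          ≡⟨ sym (^-distribʳ-* b b (suc i)) ⟩
        (b * b) ^ suc i
          ≤⟨ ^-monoˡ-≤ (suc i) (subst (λ t → t * t ≤ h i * h (suc (suc i))) h₁≡ (closedWalks-log-convex i)) ⟩
        (h i * h (suc (suc i))) ^ suc i
          ≡⟨ ^-distribʳ-* (h i) (h (suc (suc i))) (suc i) ⟩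
        h i ^ suc i * h (suc (suc i)) ^ suc i
          ≤⟨ *-monoˡ-≤ (h (suc (suc i)) ^ suc i) (subst (λ t → h i ^ suc i ≤ h 0 * t ^ i) h₁≡ (closedWalks-power-bound i)) ⟩
        h 0 * b ^ i * h (suc (suc i)) ^ suc i
          ≡⟨ solve 3 (λ z p c → z :* p :* c := p :* (z :* c)) refl (h 0) (b ^ i) (h (suc (suc i)) ^ suc i) ⟩
        b ^ i * (h 0 * h (suc (suc i)) ^ suc i) ∎)
    where
    open ≤-Reasoning
    h : ℕ → ℕ
    h j = closedWalks (j + j)
    b = suc b-1

  closedWalks-0 : closedWalks 0 ≡ n
  closedWalks-0 = trans (∑-cong V δ-refl) (trans (∑-const V 1) (trans (*-identityʳ _) (length-fins n)))

  module _ (d : ℕ) (d≤rowSum : ∀ x → d ≤ ∑ V (A x)) where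

    rowSum-A^ : ∀ k x → d ^ k ≤ ∑ V (∏ (A^ k) x)
    rowSum-A^ zero x = ≤-reflexive (sym (∑-δ≡1 x))
    rowSum-A^ (suc k) x = begin
        d * d ^ k                                    ≤⟨ *-monoˡ-≤ (d ^ k) (d≤rowSum x) ⟩
        ∑ V (A x) * d ^ k                            ≡⟨ sym (∑-*ʳ V (d ^ k) (A x)) ⟩
        ∑[ z ∈ V ] A x z * d ^ k                     ≤⟨ ∑-mono-≤ V (λ z → *-monoʳ-≤ (A x z) (rowSum-A^ k z)) ⟩
        ∑[ z ∈ V ] A x z * ∑ V (∏ (A^ k) z)          ≡⟨ ∑-cong V (λ z → sym (∑-*ˡ V (A x z) _)) ⟩
        ∑[ z ∈ V ] ∑[ y ∈ V ] A x z * ∏ (A^ k) z y   ≡⟨ ∑-comm V V _ ⟩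
        ∑ V (∏ (A^ (suc k)) x)                       ∎
      where open ≤-Reasoning

    -- Cauchy–Schwarz against the all-ones matrix: (n dᵏ)² ≤ (∑ₓᵧ (Aᵏ)ₓᵧ)² ≤ n² ⟨Aᵏ, Aᵏ⟩.
    closedWalks-lower-bound : 1 ≤ n → ∀ k → d ^ k * d ^ k ≤ closedWalks (k + k)
    closedWalks-lower-bound 1≤n k = *-cancelˡ-≤ (n * n) {{m*n≢0 n n {{>-nonZero 1≤n}} {{>-nonZero 1≤n}}}} (begin
        (n * n) * (d ^ k * d ^ k)   ≡⟨ solve 2 (λ n d → (n :* n) :* (d :* d) := (n :* d) :* (n :* d)) refl n (d ^ k) ⟩
        (n * d ^ k) * (n * d ^ k)   ≤⟨ *-mono-≤ n·d^k≤ n·d^k≤ ⟩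
        ⟨ Q , 𝟏 ⟩ * ⟨ Q , 𝟏 ⟩        ≤⟨ ⟨,⟩-cauchy-schwarz Q 𝟏 ⟩
        ⟨ Q , Q ⟩ * ⟨ 𝟏 , 𝟏 ⟩        ≡⟨ cong₂ _*_ (⟨A^,A^⟩ k k) ⟨𝟏,𝟏⟩ ⟩
        closedWalks (k + k) * (n * n) ≡⟨ *-comm (closedWalks (k + k)) (n * n) ⟩
        (n * n) * closedWalks (k + k) ∎)
      where
      open ≤-Reasoning
      Q 𝟏 : Mat
      Q = ∏ (A^ k)
      𝟏 x y = 1
      ⟨𝟏,𝟏⟩ : ⟨ 𝟏 , 𝟏 ⟩ ≡ n * n
      ⟨𝟏,𝟏⟩ = trans (∑-cong V (λ x → trans (∑-const V 1) (trans (*-identityʳ _) (length-fins n))))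
                    (trans (∑-const V n) (cong (_* n) (length-fins n)))
      n·d^k≤ : n * d ^ k ≤ ⟨ Q , 𝟏 ⟩
      n·d^k≤ = begin
          n * d ^ k                    ≡⟨ cong (_* d ^ k) (sym (length-fins n)) ⟩
          Data.List.length V * d ^ k   ≡⟨ sym (∑-const V (d ^ k)) ⟩
          ∑[ x ∈ V ] d ^ k             ≤⟨ ∑-mono-≤ V (rowSum-A^ k) ⟩
          ∑[ x ∈ V ] ∑ V (Q x)         ≡⟨ ∑-cong V (λ x → ∑-cong V (λ y → sym (*-identityʳ (Q x y)))) ⟩
          ⟨ Q , 𝟏 ⟩                    ∎

  twoMarked : ℕ → ℕ → ℕ → Mat → List Mat
  twoMarked i a b M = A^ i ++ M ∷ A^ a ++ M ∷ A^ b

  length-twoMarked : ∀ i a b M → length (twoMarked i a b M) ≡ i + suc (a + suc b)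
  length-twoMarked i a b M = trans (length-++ (A^ i))
    (cong₂ _+_ (length-replicate i) (cong suc (trans (length-++ (A^ a)) (cong₂ _+_ (length-replicate a) (cong suc (length-replicate b))))))

  tr-twoMarked : ∀ i a b M → tr (∏ (twoMarked i a b M)) ≡ markedTrace M a (b + i)
  tr-twoMarked i a b M = trans (tr-∏-rotate (A^ i) (M ∷ A^ a ++ M ∷ A^ b))
    (cong (λ l → tr (∏ l)) (trans (++-assoc (M ∷ A^ a) (M ∷ A^ b) (A^ i)) (cong (λ l → M ∷ A^ a ++ M ∷ l) (A^-+ b i))))

  weight-twoMarked : ∀ i a b H x l y d → length l ≡ i + suc (a + b) →
    weight (twoMarked i a b (H ⊙ A)) x l y
      ≡ uncurry H (lookupOr d (edges x l y) i) * (uncurry H (lookupOr d (edges x l y) (i + suc a)) * weight (A^ (i + suc (a + suc b))) x l y)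
  weight-twoMarked i a b H x l y d len = begin
      weight (A^ i ++ H ⊙ A ∷ A^ a ++ H ⊙ A ∷ A^ b) x l y
        ≡⟨ weight-⊙ (A^ i) (A^ a ++ H ⊙ A ∷ A^ b) H A x l y d (≤-trans (≤-reflexive (length-replicate i)) (subst (i ≤_) (sym len) (m≤m+n i _))) ⟩
      e (length (A^ i)) * weight (A^ i ++ A ∷ A^ a ++ H ⊙ A ∷ A^ b) x l y
        ≡⟨ cong₂ (λ u v → e u * weight v x l y) (length-replicate i) (sym (++-assoc (A^ i) (A ∷ A^ a) (H ⊙ A ∷ A^ b))) ⟩
      e i * weight ((A^ i ++ A ∷ A^ a) ++ H ⊙ A ∷ A^ b) x l y
        ≡⟨ cong (e i *_) (weight-⊙ (A^ i ++ A ∷ A^ a) (A^ b) H A x l y d (subst₂ _≤_ (sym length-prefix) (sym len) (+-monoʳ-≤ i (s≤s (m≤m+n a b))))) ⟩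
      e i * (e (length (A^ i ++ A ∷ A^ a)) * weight ((A^ i ++ A ∷ A^ a) ++ A ∷ A^ b) x l y)
        ≡⟨ cong₂ (λ u v → e i * (e u * weight v x l y)) length-prefix unmarked ⟩
      e i * (e (i + suc a) * weight (A^ (i + suc (a + suc b))) x l y) ∎
    where
    open ≡-Reasoning
    e : ℕ → ℕ
    e j = uncurry H (lookupOr d (edges x l y) j)
    length-prefix : length (A^ i ++ A ∷ A^ a) ≡ i + suc a
    length-prefix = trans (length-++ (A^ i)) (cong₂ _+_ (length-replicate i) (cong suc (length-replicate a)))
    unmarked : (A^ i ++ A ∷ A^ a) ++ A ∷ A^ b ≡ A^ (i + suc (a + suc b))
    unmarked = trans (++-assoc (A^ i) (A ∷ A^ a) (A ∷ A^ b)) (trans (cong (λ t → A^ i ++ A ∷ t) (A^-+ a (suc b))) (A^-+ i (suc (a + suc b))))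

module AdjacencyMarks {n : ℕ} (G : Graph n) (κ : ProperEdgeColouring G) where

  open import Data.Nat
  open import Data.Nat.Properties
  open import Data.Nat.Solver using (module +-*-Solver)
  open import Data.List using (List; []; _∷_; _++_; length; filter)
  open import Data.List.Extrema.Nat using (argmax; argmin; f[argmin]≤f[xs]; f[xs]≤f[argmax])
  open import Data.List.Relation.Unary.All using () renaming (lookup to lookupAll)
  open import Data.Bool using (true; false)
  open import Data.Bool.Properties using () renaming (_≟_ to _≟ᵇ_)
  open import Data.Fin using (Fin; toℕ)
  open import Data.Fin.Properties using (toℕ<n) renaming (_≟_ to _≟ᶠ_)
  open import Relation.Binary.PropositionalEquality
  open import Relation.Nullary using (yes; no; contradiction)
  open +-*-Solver using (solve; _:=_; _:+_; _:*_; con)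
  open Sums
  open FinSums
  open Matrices n

  A : Mat
  A x y = 𝟙 (adj G x y)

  A-sym : Symmetric A
  A-sym x y = cong 𝟙 (symm G x y)

  open Powers n A A-sym public

  degree : Fin n → ℕ
  degree x = ∑ V (A x)

  deg≡degree : ∀ x → deg G x ≡ degree x
  deg≡degree x = length-filter V
    where
    length-filter : ∀ l → length (filter (λ y → adj G x y ≟ᵇ true) l) ≡ ∑ l (A x)
    length-filter [] = refl
    length-filter (y ∷ l) with adj G x y
    ... | true = cong suc (length-filter l)
    ... | false = length-filter l

  module _ (x₀ : Fin n) where

    maxDegreeVertex minDegreeVertex : Fin n
    maxDegreeVertex = argmax degree x₀ V
    minDegreeVertex = argmin degree x₀ V

    degree≤max : ∀ x → degree x ≤ degree maxDegreeVertex
    degree≤max x = lookupAll (f[xs]≤f[argmax] x₀ V) (∈-fins x)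

    min≤degree : ∀ x → degree minDegreeVertex ≤ degree x
    min≤degree x = lookupAll (f[argmin]≤f[xs] x₀ V) (∈-fins x)

  colourBound : ℕ
  colourBound = suc (∑[ x ∈ V ] ∑[ y ∈ V ] col κ x y)

  col<colourBound : ∀ x y → col κ x y < colourBound
  col<colourBound x y = s≤s (≤-trans (term≤∑ V (col κ x) (∈-fins y)) (term≤∑ V (λ x → ∑[ y ∈ V ] col κ x y) (∈-fins x)))

  A-irrefl : ∀ x → A x x ≡ 0
  A-irrefl x = cong 𝟙 (irrefl G x)

  A-round-trip : ∀ x z → A x z * A z x ≡ A x z
  A-round-trip x z = trans (cong (A x z *_) (A-sym z x)) (𝟙-idem _)

  degreeTrace : Mat → ℕ
  degreeTrace R = ∑[ x ∈ V ] degree x * R x x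

  degreeTrace-≤ : ∀ D → (∀ x → degree x ≤ D) → ∀ R → degreeTrace R ≤ D * tr R
  degreeTrace-≤ D degree≤D R = ≤-trans (∑-mono-≤ V (λ x → *-monoˡ-≤ (R x x) (degree≤D x))) (≤-reflexive (∑-*ˡ V D (λ x → R x x)))

  P : ℕ → Mat
  P v x y = δℕ (toℕ x) v * δ x y

  P-sym : ∀ v → Symmetric (P v)
  P-sym v x y = begin
      f x * δ x y   ≡⟨ *-comm (f x) (δ x y) ⟩
      δ x y * f x   ≡⟨ sym (δ-subst x y f) ⟩
      δ x y * f y   ≡⟨ cong₂ _*_ (δ-sym x y) refl ⟩
      δ y x * f y   ≡⟨ *-comm (δ y x) (f y) ⟩
      f y * δ y x   ∎
    where
    open ≡-Reasoning
    f : Fin n → ℕ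
    f z = δℕ (toℕ z) v

  P-· : ∀ v X x y → (P v · X) x y ≡ δℕ (toℕ x) v * X x y
  P-· v X x y = trans (∑-cong V (λ z → *-assoc (δℕ (toℕ x) v) (δ x z) (X z y)))
                 (trans (∑-*ˡ V (δℕ (toℕ x) v) _) (cong (δℕ (toℕ x) v *_) (∑-δ x (λ z → X z y))))

  Aᵥ : ℕ → Mat
  Aᵥ v x y = δℕ (toℕ x) v * A x y

  Aᶜ : ℕ → Mat
  Aᶜ γ x y = δℕ (col κ x y) γ * A x y

  Aᶜ-sym : ∀ γ → Symmetric (Aᶜ γ)
  Aᶜ-sym γ x y with adj G x y in xy
  ... | true = cong₂ (λ s t → δℕ s γ * 𝟙 t) (colSym κ x y xy) (sym (trans (symm G y x) xy))
  ... | false = trans (*-zeroʳ (δℕ (col κ x y) γ))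
    (sym (trans (cong (λ t → δℕ (col κ y x) γ * 𝟙 t) (trans (symm G y x) xy)) (*-zeroʳ (δℕ (col κ y x) γ))))

  markedTrace-Aᵥ : ∀ v a b → markedTrace (Aᵥ v) a b ≡ markedTrace (P v) (suc a) (suc b)
  markedTrace-Aᵥ v a b = tr-cong (≈-trans (∏-replace [] (A^ a ++ Aᵥ v ∷ A^ b) Aᵥ≈)
                                 (≈-trans (∏-expand [] (P v) A (A^ a ++ Aᵥ v ∷ A^ b))
                                 (≈-trans (∏-replace (P v ∷ A ∷ A^ a) (A^ b) Aᵥ≈)
                                          (∏-expand (P v ∷ A ∷ A^ a) (P v) A (A^ b)))))
    where
    Aᵥ≈ : Aᵥ v ≈ P v · A
    Aᵥ≈ x y = sym (P-· v A x y)

  ∑-tr-P-sandwich : ∀ X Y → (∑[ v ∈ range n ] tr (P v · (X · (P v · Y)))) ≡ (∑[ x ∈ V ] X x x * Y x x)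
  ∑-tr-P-sandwich X Y = begin
      ∑[ v ∈ range n ] ∑[ x ∈ V ] (P v · (X · (P v · Y))) x x
        ≡⟨ ∑-comm (range n) V _ ⟩
      ∑[ x ∈ V ] ∑[ v ∈ range n ] (P v · (X · (P v · Y))) x x
        ≡⟨ ∑-cong V (λ x → ∑-cong (range n) (λ v → trans (P-· v (X · (P v · Y)) x x)
                                                      (cong (δℕ (toℕ x) v *_) (∑-cong V (λ z → cong (X x z *_) (P-· v Y z x)))))) ⟩
      ∑[ x ∈ V ] ∑[ v ∈ range n ] δℕ (toℕ x) v * (∑[ z ∈ V ] X x z * (δℕ (toℕ z) v * Y z x))
        ≡⟨ ∑-cong V (λ x → trans (∑-cong (range n) (λ v → sym (∑-*ˡ V (δℕ (toℕ x) v) _))) (∑-comm (range n) V _)) ⟩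
      ∑[ x ∈ V ] ∑[ z ∈ V ] ∑[ v ∈ range n ] δℕ (toℕ x) v * (X x z * (δℕ (toℕ z) v * Y z x))
        ≡⟨ ∑-cong V (λ x → ∑-cong V (λ z → trans (∑-cong (range n) (λ v → rearrange (δℕ (toℕ x) v) (X x z) (δℕ (toℕ z) v) (Y z x)))
                                                  (∑-*ˡ (range n) (X x z * Y z x) _))) ⟩
      ∑[ x ∈ V ] ∑[ z ∈ V ] X x z * Y z x * (∑[ v ∈ range n ] δℕ (toℕ x) v * δℕ (toℕ z) v)
        ≡⟨ ∑-cong V (λ x → ∑-cong V (λ z → cong (X x z * Y z x *_) (trans (sym (δℕ-split n (toℕ x) (toℕ z) (toℕ<n x))) (δℕ-toℕ x z)))) ⟩
      ∑[ x ∈ V ] ∑[ z ∈ V ] X x z * Y z x * δ x z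
        ≡⟨ ∑-cong V (λ x → trans (∑-cong V (λ z → *-comm (X x z * Y z x) (δ x z))) (∑-δ x (λ z → X x z * Y z x))) ⟩
      ∑[ x ∈ V ] X x x * Y x x ∎
    where
    open ≡-Reasoning
    rearrange : ∀ d a e b → d * (a * (e * b)) ≡ a * b * (d * e)
    rearrange = solve 4 (λ d a e b → d :* (a :* (e :* b)) := a :* b :* (d :* e)) refl

  module Pᶠ = MarkedFamily (range n) P P-sym

  Φᴾ-diagonal : ∀ p q → Pᶠ.Φ p q ≡ (∑[ x ∈ V ] ∏ (A^ p) x x * ∏ (A^ q) x x)
  Φᴾ-diagonal p q = trans (∑-cong (range n) (λ v → tr-cong (·-cong (≈-refl {P v}) (∏-++ (A^ p) (P v ∷ A^ q)))))
                          (∑-tr-P-sandwich (∏ (A^ p)) (∏ (A^ q)))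

  Φᴾ-1 : ∀ q → Pᶠ.Φ 1 q ≡ 0
  Φᴾ-1 q = trans (Φᴾ-diagonal 1 q) (trans (∑-cong V (λ x → cong (_* ∏ (A^ q) x x) (trans (∏-[ A ] x x) (A-irrefl x)))) (∑-zero V))

  Φᴾ-2 : ∀ q → Pᶠ.Φ 2 q ≡ degreeTrace (∏ (A^ q))
  Φᴾ-2 q = trans (Φᴾ-diagonal 2 q) (∑-cong V (λ x → cong (_* ∏ (A^ q) x x)
             (trans (∑-cong V (λ z → cong (A x z *_) (∏-[ A ] z x))) (∑-cong V (A-round-trip x)))))

  vertex-coincidences-≤ : ∀ D → (∀ x → degree x ≤ D) → ∀ K a b → a + b ≡ K + K →
    (∑[ v ∈ range n ] markedTrace (Aᵥ v) a b) ≤ D * closedWalks (K + K)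
  vertex-coincidences-≤ D degree≤D K a b a+b≡ =
    subst (_≤ D * closedWalks (K + K)) (sym (∑-cong (range n) (λ v → markedTrace-Aᵥ v a b))) (bound K a b a+b≡)
    where
    bound : ∀ K a b → a + b ≡ K + K → Pᶠ.Φ (suc a) (suc b) ≤ D * closedWalks (K + K)
    bound K zero b _ = ≤-trans (≤-reflexive (Φᴾ-1 (suc b))) z≤n
    bound K (suc a) zero _ = ≤-trans (≤-reflexive (trans (Pᶠ.Φ-sym (suc (suc a)) 1) (Φᴾ-1 (suc (suc a))))) z≤n
    bound zero (suc a) (suc b) ()
    bound (suc K) (suc a) (suc b) a+b≡ = begin
        Pᶠ.Φ (1 + 1 + a) (1 + 1 + b)         ≤⟨ Pᶠ.Φ-maximum 1 K a b a+b≡′ ⟩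
        Pᶠ.Φ 2 (2 + (K + K))                 ≡⟨ Φᴾ-2 (2 + (K + K)) ⟩
        degreeTrace (∏ (A^ (2 + (K + K))))   ≤⟨ degreeTrace-≤ D degree≤D (∏ (A^ (2 + (K + K)))) ⟩
        D * closedWalks (2 + (K + K))        ≡⟨ cong (λ t → D * closedWalks (suc t)) (sym (+-suc K K)) ⟩
        D * closedWalks (suc K + suc K)      ∎
      where
      open ≤-Reasoning
      a+b≡′ : a + b ≡ K + K
      a+b≡′ = suc-injective (suc-injective (trans (cong suc (sym (+-suc a b))) (trans a+b≡ (cong suc (+-suc K K)))))

  module _ (C : ℕ) (col<C : ∀ x y → col κ x y < C) where

    module Aᶜᶠ = MarkedFamily (range C) Aᶜ Aᶜ-sym

    ∑-same-colour : ∀ x z w → (∑[ γ ∈ range C ] Aᶜ γ x z * Aᶜ γ z w) ≡ A x z * (A z w * δℕ (col κ x z) (col κ z w))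
    ∑-same-colour x z w = begin
        ∑[ γ ∈ range C ] δℕ (col κ x z) γ * A x z * (δℕ (col κ z w) γ * A z w)
          ≡⟨ ∑-cong (range C) (λ γ → solve 4 (λ e a f b → e :* a :* (f :* b) := a :* b :* (e :* f)) refl (δℕ (col κ x z) γ) (A x z) (δℕ (col κ z w) γ) (A z w)) ⟩
        ∑[ γ ∈ range C ] A x z * A z w * (δℕ (col κ x z) γ * δℕ (col κ z w) γ)
          ≡⟨ ∑-*ˡ (range C) (A x z * A z w) _ ⟩
        A x z * A z w * (∑[ γ ∈ range C ] δℕ (col κ x z) γ * δℕ (col κ z w) γ)
          ≡⟨ cong (A x z * A z w *_) (sym (δℕ-split C (col κ x z) (col κ z w) (col<C x z))) ⟩
        A x z * A z w * δℕ (col κ x z) (col κ z w)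
          ≡⟨ *-assoc (A x z) (A z w) _ ⟩
        A x z * (A z w * δℕ (col κ x z) (col κ z w)) ∎
      where open ≡-Reasoning

    -- Properness: edges zx and zw of the same colour have x = w.
    proper-≤ : ∀ x z w → A x z * (A z w * δℕ (col κ x z) (col κ z w)) ≤ A x z * δ x w
    proper-≤ x z w with adj G x z in xz
    ... | false = z≤n
    ... | true with adj G z w in zw
    ...   | false = z≤n
    ...   | true with col κ x z ≟ col κ z w
    ...     | no _ = z≤n
    ...     | yes same with x ≟ᶠ w
    ...       | yes refl = ≤-refl
    ...       | no x≢w = contradiction (trans (sym (colSym κ x z xz)) same)
                                       (proper κ z x w (trans (symm G z x) xz) zw x≢w)

    ∑-Aᶜ·Aᶜ-≤ : ∀ x w → (∑[ γ ∈ range C ] (Aᶜ γ · Aᶜ γ) x w) ≤ degree x * δ x w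
    ∑-Aᶜ·Aᶜ-≤ x w = begin
        ∑[ γ ∈ range C ] ∑[ z ∈ V ] Aᶜ γ x z * Aᶜ γ z w
          ≡⟨ ∑-comm (range C) V _ ⟩
        ∑[ z ∈ V ] ∑[ γ ∈ range C ] Aᶜ γ x z * Aᶜ γ z w
          ≡⟨ ∑-cong V (λ z → ∑-same-colour x z w) ⟩
        ∑[ z ∈ V ] A x z * (A z w * δℕ (col κ x z) (col κ z w))
          ≤⟨ ∑-mono-≤ V (λ z → proper-≤ x z w) ⟩
        ∑[ z ∈ V ] A x z * δ x w
          ≡⟨ ∑-*ʳ V (δ x w) (A x) ⟩
        degree x * δ x w ∎
      where open ≤-Reasoning

    Φᶜ-0 : ∀ q → Aᶜᶠ.Φ 0 q ≤ degreeTrace (∏ (A^ q))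
    Φᶜ-0 q = begin
        ∑[ γ ∈ range C ] tr (Aᶜ γ · (Aᶜ γ · R))
          ≡⟨ ∑-cong (range C) (λ γ → tr-cong (≈-sym (·-assoc (Aᶜ γ) (Aᶜ γ) R))) ⟩
        ∑[ γ ∈ range C ] ∑[ x ∈ V ] ∑[ w ∈ V ] (Aᶜ γ · Aᶜ γ) x w * R w x
          ≡⟨ ∑-comm (range C) V _ ⟩
        ∑[ x ∈ V ] ∑[ γ ∈ range C ] ∑[ w ∈ V ] (Aᶜ γ · Aᶜ γ) x w * R w x
          ≡⟨ ∑-cong V (λ x → trans (∑-comm (range C) V _) (∑-cong V (λ w → ∑-*ʳ (range C) (R w x) _))) ⟩
        ∑[ x ∈ V ] ∑[ w ∈ V ] (∑[ γ ∈ range C ] (Aᶜ γ · Aᶜ γ) x w) * R w x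
          ≤⟨ ∑-mono-≤ V (λ x → ∑-mono-≤ V (λ w → *-monoˡ-≤ (R w x) (∑-Aᶜ·Aᶜ-≤ x w))) ⟩
        ∑[ x ∈ V ] ∑[ w ∈ V ] degree x * δ x w * R w x
          ≡⟨ ∑-cong V (λ x → trans (∑-cong V (λ w → trans (*-assoc (degree x) (δ x w) (R w x)) (cong (degree x *_) (δ-subst x w (λ w → R w x)))))
                                   (trans (∑-*ˡ V (degree x) _) (cong (degree x *_) (∑-δ x (λ _ → R x x))))) ⟩
        degreeTrace R ∎
      where
      open ≤-Reasoning
      R = ∏ (A^ q)

    colour-coincidences-≤ : ∀ D → (∀ x → degree x ≤ D) → ∀ K a b → a + b ≡ K + K →
      (∑[ γ ∈ range C ] markedTrace (Aᶜ γ) a b) ≤ D * closedWalks (K + K)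
    colour-coincidences-≤ D degree≤D K a b a+b≡ = begin
        Aᶜᶠ.Φ a b                      ≤⟨ Aᶜᶠ.Φ-maximum 0 K a b a+b≡ ⟩
        Aᶜᶠ.Φ 0 (K + K)                ≤⟨ Φᶜ-0 (K + K) ⟩
        degreeTrace (∏ (A^ (K + K)))   ≤⟨ degreeTrace-≤ D degree≤D (∏ (A^ (K + K))) ⟩
        D * closedWalks (K + K)        ∎
      where open ≤-Reasoning

module NonRainbowWalks {n : ℕ} (G : Graph n) (κ : ProperEdgeColouring G) where

  open import Data.Nat
  open import Data.Nat.Properties
  open import Data.List using (List; []; _∷_; map; length)
  open import Data.List.Properties using (map-∘; map-cong)
  open import Data.List.Membership.Propositional using (_∈_)
  open import Data.Bool using (Bool; true; _∧_; not)
  open import Data.Bool.ListAction using (all)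
  open import Data.Bool.Properties using (∧-identityʳ)
  open import Data.Fin using (Fin; toℕ)
  open import Data.Fin.Properties using (toℕ<n)
  open import Data.Vec using (Vec; _∷_; toList)
  open import Data.Vec.Properties using (length-toList)
  open import Data.Product using (_×_; _,_; proj₁)
  open import Relation.Binary.PropositionalEquality hiding ([_])
  open import Data.Nat.Solver using (module +-*-Solver)
  open +-*-Solver using (solve; _:=_; _:+_; _:*_; con)
  open Sums
  open FinSums
  open Coincidences
  open Matrices n
  open Walks n
  open AdjacencyMarks G κ

  closedWalk-weight : ∀ (P : Fin n × Fin n → Bool) → (∀ a b → P (a , b) ≡ adj G a b) → ∀ x l y →
    𝟙 (all P (edges x l y)) ≡ weight (A^ (suc (length l))) x l y
  closedWalk-weight P P≡adj x [] y = trans (cong (λ t → 𝟙 (t ∧ true)) (P≡adj x y)) (cong 𝟙 (∧-identityʳ (adj G x y)))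
  closedWalk-weight P P≡adj x (z ∷ l) y = trans (𝟙-∧ (P (x , z)) _) (cong₂ _*_ (cong 𝟙 (P≡adj x z)) (closedWalk-weight P P≡adj z l y))

  -- A closed walk repeats a vertex (a colour) iff two of its edges share a vertexLabel (colourLabel).
  vertexLabel colourLabel : Fin n × Fin n → ℕ
  vertexLabel (a , b) = toℕ a
  colourLabel (a , b) = col κ a b

  sameLabel : (Fin n × Fin n → ℕ) → ℕ × ℕ → Fin n → List (Fin n) → ℕ
  sameLabel h (i , j) x l = δℕ (h (lookupOr (x , x) (edges x l x) i)) (h (lookupOr (x , x) (edges x l x) j))

  collisions : ℕ → ℕ × ℕ → Fin n → List (Fin n) → ℕ
  collisions m p x l = weight (A^ m) x l x * sameLabel vertexLabel p x l + weight (A^ m) x l x * sameLabel colourLabel p x l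

  private
    map-proj₁-edges : ∀ (x : Fin n) l y → map proj₁ (edges x l y) ≡ x ∷ l
    map-proj₁-edges x [] y = refl
    map-proj₁-edges x (z ∷ l) y = cong (x ∷_) (map-proj₁-edges z l y)

    length-edges : ∀ (x : Fin n) l y → length (edges x l y) ≡ suc (length l)
    length-edges x [] y = refl
    length-edges x (z ∷ l) y = cong suc (length-edges z l y)

  -- Defs writes the edge tests of isClosedWalk and isRainbow as pattern lambdas, hence P and colP.
  nonRainbow-≤ : ∀ (P : Fin n × Fin n → Bool) → (∀ a b → P (a , b) ≡ adj G a b) →
    ∀ (colP : Fin n × Fin n → ℕ) → (∀ a b → colP (a , b) ≡ col κ a b) → ∀ x l →
    𝟙 (all P (edges x l x) ∧ not (distinctℕ (map toℕ (x ∷ l)) ∧ distinctℕ (map colP (edges x l x))))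
      ≤ (∑[ p ∈ positionPairs (suc (length l)) ] collisions (suc (length l)) p x l)
  nonRainbow-≤ P P≡adj colP colP≡col x l = begin
      𝟙 (all P E ∧ not (distinctℕ (map toℕ (x ∷ l)) ∧ distinctℕ (map colP E)))
        ≡⟨ 𝟙-∧ (all P E) _ ⟩
      𝟙 (all P E) * 𝟙 (not (distinctℕ (map toℕ (x ∷ l)) ∧ distinctℕ (map colP E)))
        ≤⟨ *-monoʳ-≤ (𝟙 (all P E)) (≤-trans (𝟙-not-∧ (distinctℕ (map toℕ (x ∷ l))) (distinctℕ (map colP E)))
              (+-mono-≤ (¬distinct≤coincidences (map toℕ (x ∷ l))) (¬distinct≤coincidences (map colP E)))) ⟩
      𝟙 (all P E) * (coincidences (map toℕ (x ∷ l)) + coincidences (map colP E))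
        ≡⟨ cong₂ _*_ (closedWalk-weight P P≡adj x l x) (cong₂ _+_ vertex-coincidences colour-coincidences) ⟩
      cw * ((∑[ p ∈ pairs ] sameLabel vertexLabel p x l) + (∑[ p ∈ pairs ] sameLabel colourLabel p x l))
        ≡⟨ trans (cong (cw *_) (sym (∑-+ pairs _ _))) (trans (sym (∑-*ˡ pairs cw _)) (∑-cong pairs (λ p → *-distribˡ-+ cw _ _))) ⟩
      (∑[ p ∈ pairs ] collisions (suc (length l)) p x l) ∎
    where
    open ≤-Reasoning
    E = edges x l x
    cw = weight (A^ (suc (length l))) x l x
    pairs = positionPairs (suc (length l))
    vertex-coincidences : coincidences (map toℕ (x ∷ l)) ≡ (∑[ p ∈ pairs ] sameLabel vertexLabel p x l)
    vertex-coincidences = begin-equality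
        coincidences (map toℕ (x ∷ l))     ≡⟨ cong (λ t → coincidences (map toℕ t)) (sym (map-proj₁-edges x l x)) ⟩
        coincidences (map toℕ (map proj₁ E)) ≡⟨ cong coincidences (sym (map-∘ E)) ⟩
        coincidences (map vertexLabel E)   ≡⟨ coincidences-map (x , x) vertexLabel E ⟩
        ∑ (positionPairs (length E)) _     ≡⟨ cong (λ L → ∑[ p ∈ positionPairs L ] sameLabel vertexLabel p x l) (length-edges x l x) ⟩
        (∑[ p ∈ pairs ] sameLabel vertexLabel p x l) ∎
    colour-coincidences : coincidences (map colP E) ≡ (∑[ p ∈ pairs ] sameLabel colourLabel p x l)
    colour-coincidences = begin-equality
        coincidences (map colP E)          ≡⟨ cong coincidences (map-cong (λ { (a , b) → colP≡col a b }) E) ⟩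
        coincidences (map colourLabel E)   ≡⟨ coincidences-map (x , x) colourLabel E ⟩
        ∑ (positionPairs (length E)) _     ≡⟨ cong (λ L → ∑[ p ∈ positionPairs L ] sameLabel colourLabel p x l) (length-edges x l x) ⟩
        (∑[ p ∈ pairs ] sameLabel colourLabel p x l) ∎

  nonRainbow-≤ᵛ : ∀ x {m} (w : Vec (Fin n) m) →
    𝟙 (isClosedWalk G κ (x ∷ w) ∧ not (isRainbow G κ (x ∷ w))) ≤ (∑[ p ∈ positionPairs (suc m) ] collisions (suc m) p x (toList w))
  nonRainbow-≤ᵛ x {m} w =
    subst (λ L → 𝟙 (isClosedWalk G κ (x ∷ w) ∧ not (isRainbow G κ (x ∷ w)))
                   ≤ (∑[ p ∈ positionPairs (suc L) ] collisions (suc L) p x (toList w)))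
          (length-toList w) (nonRainbow-≤ _ (λ a b → refl) _ (λ a b → refl) x (toList w))

  homStar-≤-collisions : ∀ K → let m = K + suc K in
    homStar G κ (suc K) ≤ (∑[ p ∈ positionPairs (suc m) ] ∑[ x ∈ V ] ∑ᵛ m (λ w → collisions (suc m) p x (toList w)))
  homStar-≤-collisions K = begin
      homStar G κ (suc K)
        ≡⟨ countVec≡∑ᵛ (suc m) (λ w → isClosedWalk G κ w ∧ not (isRainbow G κ w)) ⟩
      ∑[ x ∈ V ] ∑ᵛ m (λ w → 𝟙 (isClosedWalk G κ (x ∷ w) ∧ not (isRainbow G κ (x ∷ w))))
        ≤⟨ ∑-mono-≤ V (λ x → ∑ᵛ-mono-≤ m (nonRainbow-≤ᵛ x)) ⟩
      ∑[ x ∈ V ] ∑ᵛ m (λ w → ∑[ p ∈ pairs ] collisions (suc m) p x (toList w))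
        ≡⟨ ∑-cong V (λ x → ∑ᵛ-∑ m pairs (λ p w → collisions (suc m) p x (toList w))) ⟩
      ∑[ x ∈ V ] ∑[ p ∈ pairs ] ∑ᵛ m (λ w → collisions (suc m) p x (toList w))
        ≡⟨ ∑-comm V pairs _ ⟩
      ∑[ p ∈ pairs ] ∑[ x ∈ V ] ∑ᵛ m (λ w → collisions (suc m) p x (toList w)) ∎
    where
    open ≤-Reasoning
    m = K + suc K
    pairs = positionPairs (suc m)

  labelled : (Fin n × Fin n → ℕ) → ℕ → Mat
  labelled h c = (λ x y → δℕ (h (x , y)) c) ⊙ A

  -- [h eᵢ = h eⱼ] = ∑_c [h eᵢ = c] [h eⱼ = c], and each summand marks the edges i and j by labelled h c.
  ∑-sameLabel : ∀ (h : Fin n × Fin n → ℕ) C → (∀ e → h e < C) → ∀ m i a b → m ≡ i + suc (a + b) →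
    (∑[ x ∈ V ] ∑ᵛ m (λ w → weight (A^ (suc m)) x (toList w) x * sameLabel h (i , i + suc a) x (toList w)))
      ≡ (∑[ c ∈ range C ] markedTrace (labelled h c) a (b + i))
  ∑-sameLabel h C h<C m i a b m≡ = begin
      ∑[ x ∈ V ] ∑ᵛ m (λ w → weight (A^ (suc m)) x (toList w) x * sameLabel h (i , i + suc a) x (toList w))
        ≡⟨ ∑-cong V (λ x → ∑ᵛ-cong m (λ w → split-label x (toList w) (trans (length-toList w) m≡))) ⟩
      ∑[ x ∈ V ] ∑ᵛ m (λ w → ∑[ c ∈ range C ] weight (marked c) x (toList w) x)
        ≡⟨ ∑-cong V (λ x → ∑ᵛ-∑ m (range C) (λ c w → weight (marked c) x (toList w) x)) ⟩
      ∑[ x ∈ V ] ∑[ c ∈ range C ] ∑ᵛ m (λ w → weight (marked c) x (toList w) x)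
        ≡⟨ ∑-comm V (range C) _ ⟩
      ∑[ c ∈ range C ] ∑[ x ∈ V ] ∑ᵛ m (λ w → weight (marked c) x (toList w) x)
        ≡⟨ ∑-cong (range C) (λ c → ∑-cong V (λ x → ∑ᵛ-weight m (marked c) x x (trans (length-twoMarked i a b _) (sym suc-m≡)))) ⟩
      ∑[ c ∈ range C ] tr (∏ (marked c))
        ≡⟨ ∑-cong (range C) (λ c → tr-twoMarked i a b (labelled h c)) ⟩
      ∑[ c ∈ range C ] markedTrace (labelled h c) a (b + i) ∎
    where
    open ≡-Reasoning
    marked : ℕ → List Mat
    marked c = twoMarked i a b (labelled h c)
    suc-m≡ : suc m ≡ i + suc (a + suc b)
    suc-m≡ = trans (cong suc m≡) (trans (sym (+-suc i (suc (a + b)))) (cong (λ t → i + suc t) (sym (+-suc a b))))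
    split-label : ∀ x l → length l ≡ i + suc (a + b) →
      weight (A^ (suc m)) x l x * sameLabel h (i , i + suc a) x l ≡ (∑[ c ∈ range C ] weight (marked c) x l x)
    split-label x l len = begin
        cw * δℕ (h eᵢ) (h eⱼ)
          ≡⟨ cong (cw *_) (δℕ-split C (h eᵢ) (h eⱼ) (h<C eᵢ)) ⟩
        cw * (∑[ c ∈ range C ] δℕ (h eᵢ) c * δℕ (h eⱼ) c)
          ≡⟨ sym (∑-*ˡ (range C) cw _) ⟩
        ∑[ c ∈ range C ] cw * (δℕ (h eᵢ) c * δℕ (h eⱼ) c)
          ≡⟨ ∑-cong (range C) (λ c → solve 3 (λ w u v → w :* (u :* v) := u :* (v :* w)) refl cw (δℕ (h eᵢ) c) (δℕ (h eⱼ) c)) ⟩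
        ∑[ c ∈ range C ] δℕ (h eᵢ) c * (δℕ (h eⱼ) c * cw)
          ≡⟨ ∑-cong (range C) (λ c → sym (trans (weight-twoMarked i a b (λ u v → δℕ (h (u , v)) c) x l x (x , x) len)
                                                  (cong (λ t → δℕ (h eᵢ) c * (δℕ (h eⱼ) c * weight (A^ t) x l x)) (sym suc-m≡)))) ⟩
        ∑[ c ∈ range C ] weight (marked c) x l x ∎
      where
      cw = weight (A^ (suc m)) x l x
      eᵢ = lookupOr (x , x) (edges x l x) i
      eⱼ = lookupOr (x , x) (edges x l x) (i + suc a)

  module _ (D : ℕ) (degree≤D : ∀ x → degree x ≤ D) (C : ℕ) (col<C : ∀ x y → col κ x y < C) where

    collisions-≤ : ∀ K i a b → K + suc K ≡ i + suc (a + b) → let m = K + suc K in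
      (∑[ x ∈ V ] ∑ᵛ m (λ w → collisions (suc m) (i , i + suc a) x (toList w))) ≤ D * closedWalks (K + K) + D * closedWalks (K + K)
    collisions-≤ K i a b m≡ = begin
        ∑[ x ∈ V ] ∑ᵛ m (λ w → cw x w * sameLabel vertexLabel (i , i + suc a) x (toList w) + cw x w * sameLabel colourLabel (i , i + suc a) x (toList w))
          ≡⟨ trans (∑-cong V (λ x → ∑ᵛ-+ m _ _)) (∑-+ V _ _) ⟩
        (∑[ x ∈ V ] ∑ᵛ m (λ w → cw x w * sameLabel vertexLabel (i , i + suc a) x (toList w)))
          + (∑[ x ∈ V ] ∑ᵛ m (λ w → cw x w * sameLabel colourLabel (i , i + suc a) x (toList w)))
          ≡⟨ cong₂ _+_ (∑-sameLabel vertexLabel n (λ { (u , _) → toℕ<n u }) m i a b m≡)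
                       (∑-sameLabel colourLabel C (λ { (u , v) → col<C u v }) m i a b m≡) ⟩
        (∑[ v ∈ range n ] markedTrace (Aᵥ v) a (b + i)) + (∑[ γ ∈ range C ] markedTrace (Aᶜ γ) a (b + i))
          ≤⟨ +-mono-≤ (vertex-coincidences-≤ D degree≤D K a (b + i) a+b+i≡) (colour-coincidences-≤ C col<C D degree≤D K a (b + i) a+b+i≡) ⟩
        D * closedWalks (K + K) + D * closedWalks (K + K) ∎
      where
      open ≤-Reasoning
      m = K + suc K
      cw : Fin n → Vec (Fin n) m → ℕ
      cw x w = weight (A^ (suc m)) x (toList w) x
      a+b+i≡ : a + (b + i) ≡ K + K
      a+b+i≡ = suc-injective (begin-equality
        suc (a + (b + i))  ≡⟨ cong suc (solve 3 (λ a b i → a :+ (b :+ i) := i :+ (a :+ b)) refl a b i) ⟩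
        suc (i + (a + b))  ≡⟨ sym (+-suc i (a + b)) ⟩
        i + suc (a + b)    ≡⟨ sym m≡ ⟩
        K + suc K          ≡⟨ +-suc K K ⟩
        suc (K + K)        ∎)

    homStar-≤ : ∀ K → homStar G κ (suc K) ≤ 8 * (suc K * suc K) * (D * closedWalks (K + K))
    homStar-≤ K = begin
        homStar G κ (suc K)
          ≤⟨ homStar-≤-collisions K ⟩
        ∑[ p ∈ positionPairs (suc m) ] ∑[ x ∈ V ] ∑ᵛ m (λ w → collisions (suc m) p x (toList w))
          ≤⟨ ∑-bounded (positionPairs (suc m)) _ _ pair-≤ ⟩
        length (positionPairs (suc m)) * (D * closedWalks (K + K) + D * closedWalks (K + K))
          ≤⟨ *-monoˡ-≤ _ (length-positionPairs (suc m)) ⟩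
        (suc m * suc m) * (D * closedWalks (K + K) + D * closedWalks (K + K))
          ≡⟨ solve 2 (λ K x → (con 1 :+ (K :+ (con 1 :+ K))) :* (con 1 :+ (K :+ (con 1 :+ K))) :* (x :+ x)
                              := con 8 :* ((con 1 :+ K) :* (con 1 :+ K)) :* x) refl K (D * closedWalks (K + K)) ⟩
        8 * (suc K * suc K) * (D * closedWalks (K + K)) ∎
      where
      open ≤-Reasoning
      m = K + suc K
      pair-≤ : ∀ p → p ∈ positionPairs (suc m) →
        (∑[ x ∈ V ] ∑ᵛ m (λ w → collisions (suc m) p x (toList w))) ≤ D * closedWalks (K + K) + D * closedWalks (K + K)
      pair-≤ (i , j) p∈ with ∈-positionPairs-shape {m} p∈
      ... | a , b , refl , m≡ = collisions-≤ K i a b m≡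

module HomCount {n : ℕ} (G : Graph n) (κ : ProperEdgeColouring G) where

  open import Data.Nat
  open import Data.Nat.Properties
  open import Data.List.Properties using (length-replicate)
  open import Data.Bool using (Bool; _∧_)
  open import Data.Fin using (Fin)
  open import Data.Fin.Properties using () renaming (_≟_ to _≟ᶠ_)
  open import Data.Vec using (Vec; _∷_; toList)
  open import Data.Vec.Properties using (length-toList)
  open import Data.Product using (Σ; _,_; proj₁)
  open import Relation.Binary.PropositionalEquality
  open import Relation.Nullary.Decidable using (isYes)
  open Sums
  open FinSums
  open Matrices n
  open Walks n
  open AdjacencyMarks G κ
  open NonRainbowWalks G κ using (closedWalk-weight)

  homxyTest : (k : ℕ) (x y : Fin n) → Σ (Vec (Fin n) (k + k) → Bool) λ P → homxy G κ k x y ≡ countVec n (k + k) P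
  homxyTest k x y = _ , refl

  -- Defs keeps the position test of homxy local; unification names it, with the position fixed to K.
  mutual
    indexTest : ℕ → Fin n → Fin n → ∀ {m} → Vec (Fin n) m → Bool
    indexTest = _

    homxyTest-∷ : ∀ K x y v (w : Vec (Fin n) (K + suc K)) →
      proj₁ (homxyTest (suc K) x y) (v ∷ w) ≡ (isClosedWalk G κ (v ∷ w) ∧ (isYes (v ≟ᶠ x) ∧ indexTest K x y w))
    homxyTest-∷ K with K + suc K
    ... | m = λ x y v w → refl

  ∑-indexTest : ∀ i x {m} (w : Vec (Fin n) m) → i < m → (∑[ y ∈ V ] 𝟙 (indexTest i x y w)) ≡ 1
  ∑-indexTest zero x (v ∷ w) _ = ∑-δ≡1 v
  ∑-indexTest (suc i) x (v ∷ w) (s≤s i<m) = ∑-indexTest i x w i<m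

  hom≡closedWalks : ∀ K → hom G κ (suc K) ≡ closedWalks (suc K + suc K)
  hom≡closedWalks K = begin
      ∑[ x ∈ V ] ∑[ y ∈ V ] homxy G κ (suc K) x y
        ≡⟨ ∑-cong V (λ x → ∑-cong V (λ y → trans (countVec≡∑ᵛ (suc m) (proj₁ (homxyTest (suc K) x y)))
                                                 (∑-cong V (λ v → ∑ᵛ-cong m (λ w → unfold x y v w))))) ⟩
      ∑[ x ∈ V ] ∑[ y ∈ V ] ∑[ v ∈ V ] ∑ᵛ m (λ w → δ v x * (𝟙 (indexTest K x y w) * cw v w))
        ≡⟨ ∑-cong V (λ x → trans (∑-cong V (λ y → ∑-cong V (λ v → ∑ᵛ-*ˡ m (δ v x) _))) (∑-comm V V _)) ⟩
      ∑[ x ∈ V ] ∑[ v ∈ V ] ∑[ y ∈ V ] δ v x * ∑ᵛ m (λ w → 𝟙 (indexTest K x y w) * cw v w)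
        ≡⟨ ∑-cong V (λ x → ∑-cong V (λ v → trans (∑-*ˡ V (δ v x) _) (cong (δ v x *_) (sum-indexTest x v)))) ⟩
      ∑[ x ∈ V ] ∑[ v ∈ V ] δ v x * ∑ᵛ m (cw v)
        ≡⟨ trans (∑-comm V V _) (∑-cong V (λ v → trans (∑-*ʳ V _ (δ v)) (trans (cong (_* ∑ᵛ m (cw v)) (∑-δ≡1 v)) (+-identityʳ _)))) ⟩
      ∑[ v ∈ V ] ∑ᵛ m (cw v)
        ≡⟨ ∑-cong V (λ v → trans (∑ᵛ-cong m (λ w → trans (closedWalk-weight _ (λ a b → refl) v (toList w) v)
                                                             (cong (λ L → weight (A^ (suc L)) v (toList w) v) (length-toList w))))
                                 (∑ᵛ-weight m (A^ (suc m)) v v (length-replicate (suc m)))) ⟩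
      closedWalks (suc m) ∎
    where
    open ≡-Reasoning
    m = K + suc K
    cw : Fin n → Vec (Fin n) m → ℕ
    cw v w = 𝟙 (isClosedWalk G κ (v ∷ w))
    unfold : ∀ x y v w → 𝟙 (proj₁ (homxyTest (suc K) x y) (v ∷ w)) ≡ δ v x * (𝟙 (indexTest K x y w) * cw v w)
    unfold x y v w = begin
        𝟙 (proj₁ (homxyTest (suc K) x y) (v ∷ w))
          ≡⟨ cong 𝟙 (homxyTest-∷ K x y v w) ⟩
        𝟙 (isClosedWalk G κ (v ∷ w) ∧ (isYes (v ≟ᶠ x) ∧ indexTest K x y w))
          ≡⟨ trans (𝟙-∧ (isClosedWalk G κ (v ∷ w)) _) (cong (cw v w *_) (𝟙-∧ (isYes (v ≟ᶠ x)) (indexTest K x y w))) ⟩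
        cw v w * (δ v x * 𝟙 (indexTest K x y w))
          ≡⟨ trans (*-comm (cw v w) _) (*-assoc (δ v x) _ _) ⟩
        δ v x * (𝟙 (indexTest K x y w) * cw v w) ∎
    sum-indexTest : ∀ x v → (∑[ y ∈ V ] ∑ᵛ m (λ w → 𝟙 (indexTest K x y w) * cw v w)) ≡ ∑ᵛ m (cw v)
    sum-indexTest x v = begin
        ∑[ y ∈ V ] ∑ᵛ m (λ w → 𝟙 (indexTest K x y w) * cw v w)
          ≡⟨ sym (∑ᵛ-∑ m V _) ⟩
        ∑ᵛ m (λ w → ∑[ y ∈ V ] 𝟙 (indexTest K x y w) * cw v w)
          ≡⟨ ∑ᵛ-cong m (λ w → trans (∑-*ʳ V (cw v w) _) (trans (cong (_* cw v w) (∑-indexTest K x w (m<m+n K z<s))) (+-identityʳ _))) ⟩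
        ∑ᵛ m (cw v) ∎

module RationalArithmetic where

  open import Data.Nat as ℕ using (zero; suc; z≤n; s≤s)
  import Data.Nat.Properties as ℕ
  open import Data.Integer as ℤ using (+_)
  import Data.Integer.Properties as ℤ
  open import Data.Rational using (ℚ; _≤_; _<_; _*_; ½; 0ℚ; 1ℚ; mkℚ; _/_; nonNegative; positive; *≤*)
  open import Data.Rational.Properties
  open import Data.Rational.Solver using (module +-*-Solver)
  open import Data.Nat.Coprimality using (1-coprimeTo) renaming (sym to coprime-sym)
  open import Relation.Binary.PropositionalEquality
  open import Relation.Nullary using (yes; no; contradiction)
  open +-*-Solver using (solve; _:=_; _:*_; con)

  ℕtoℚ≡mkℚ : ∀ m → ℕtoℚ m ≡ mkℚ (+ m) 0 (coprime-sym (1-coprimeTo m))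
  ℕtoℚ≡mkℚ m = normalize-coprime {m} {0} (coprime-sym (1-coprimeTo m))

  ℕtoℚ-mono-≤ : ∀ {a b} → a ℕ.≤ b → ℕtoℚ a ≤ ℕtoℚ b
  ℕtoℚ-mono-≤ {a} {b} a≤b rewrite ℕtoℚ≡mkℚ a | ℕtoℚ≡mkℚ b =
    *≤* (subst₂ ℤ._≤_ (sym (ℤ.*-identityʳ (+ a))) (sym (ℤ.*-identityʳ (+ b))) (ℤ.+≤+ a≤b))

  ℕtoℚ-* : ∀ a b → ℕtoℚ (a ℕ.* b) ≡ ℕtoℚ a * ℕtoℚ b
  ℕtoℚ-* a b rewrite ℕtoℚ≡mkℚ a | ℕtoℚ≡mkℚ b = cong (_/ 1) (ℤ.pos-* a b)

  ℕtoℚ-^ : ∀ a k → ℕtoℚ (a ℕ.^ k) ≡ ℕtoℚ a ^ℚ k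
  ℕtoℚ-^ a zero = refl
  ℕtoℚ-^ a (suc k) = trans (ℕtoℚ-* a (a ℕ.^ k)) (cong (ℕtoℚ a *_) (ℕtoℚ-^ a k))

  0≤ℕtoℚ : ∀ a → 0ℚ ≤ ℕtoℚ a
  0≤ℕtoℚ a = ℕtoℚ-mono-≤ {0} {a} z≤n

  *-mono-≤-nonNeg : ∀ {a b c e} → 0ℚ ≤ a → 0ℚ ≤ c → a ≤ b → c ≤ e → a * c ≤ b * e
  *-mono-≤-nonNeg {a} {b} {c} {e} 0≤a 0≤c a≤b c≤e =
    ≤-trans (*-monoʳ-≤-nonNeg c {{nonNegative 0≤c}} a≤b) (*-monoˡ-≤-nonNeg b {{nonNegative (≤-trans 0≤a a≤b)}} c≤e)

  0≤* : ∀ {a b} → 0ℚ ≤ a → 0ℚ ≤ b → 0ℚ ≤ a * b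
  0≤* 0≤a 0≤b = *-mono-≤-nonNeg ≤-refl ≤-refl 0≤a 0≤b

  0<* : ∀ {a b} → 0ℚ < a → 0ℚ < b → 0ℚ < a * b
  0<* {a} {b} 0<a 0<b = ≤-<-trans (≤-reflexive (sym (*-zeroˡ b))) (*-monoˡ-<-pos b {{positive 0<b}} 0<a)

  0≤^ : ∀ {a} k → 0ℚ ≤ a → 0ℚ ≤ a ^ℚ k
  0≤^ zero 0≤a = 0≤ℕtoℚ 1
  0≤^ (suc k) 0≤a = 0≤* 0≤a (0≤^ k 0≤a)

  0<^ : ∀ {a} k → 0ℚ < a → 0ℚ < a ^ℚ k
  0<^ zero 0<a = positive⁻¹ 1ℚ
  0<^ (suc k) 0<a = 0<* 0<a (0<^ k 0<a)

  ^-mono-≤ : ∀ {a b} k → 0ℚ ≤ a → a ≤ b → a ^ℚ k ≤ b ^ℚ k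
  ^-mono-≤ zero 0≤a a≤b = ≤-refl
  ^-mono-≤ (suc k) 0≤a a≤b = *-mono-≤-nonNeg 0≤a (0≤^ k 0≤a) a≤b (^-mono-≤ k 0≤a a≤b)

  ^-distribʳ-* : ∀ a b k → (a * b) ^ℚ k ≡ a ^ℚ k * b ^ℚ k
  ^-distribʳ-* a b zero = refl
  ^-distribʳ-* a b (suc k) = trans (cong ((a * b) *_) (^-distribʳ-* a b k))
    (solve 4 (λ a b x y → (a :* b) :* (x :* y) := (a :* x) :* (b :* y)) refl a b (a ^ℚ k) (b ^ℚ k))

  ^-mono-< : ∀ {a b} K → 0ℚ ≤ a → a < b → a ^ℚ suc K < b ^ℚ suc K
  ^-mono-< {a} {b} K 0≤a a<b = ≤-<-trans (*-monoˡ-≤-nonNeg a {{nonNegative 0≤a}} (^-mono-≤ K 0≤a (<⇒≤ a<b)))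
    (*-monoˡ-<-pos (b ^ℚ K) {{positive (0<^ K (≤-<-trans 0≤a a<b))}} a<b)

  ^-cancel-≤ : ∀ {a b} K → 0ℚ ≤ a → 0ℚ ≤ b → a ^ℚ suc K ≤ b ^ℚ suc K → a ≤ b
  ^-cancel-≤ {a} {b} K 0≤a 0≤b aᵏ≤bᵏ with a ≤? b
  ... | yes a≤b = a≤b
  ... | no a≰b = contradiction (≤-<-trans aᵏ≤bᵏ (^-mono-< K 0≤b (≰⇒> a≰b))) (<-irrefl refl)

  module _ (K : ℕ) (d μ S : ℚ) (1≤d : 1ℚ ≤ d) (1≤μ : 1ℚ ≤ μ) (1≤S : 1ℚ ≤ S) where

    private
      k = suc K
      kq = ℕtoℚ k
      0≤1 : 0ℚ ≤ 1ℚ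
      0≤1 = 0≤ℕtoℚ 1
      0≤S = ≤-trans 0≤1 1≤S
      0≤μ = ≤-trans 0≤1 1≤μ
      0≤d = ≤-trans 0≤1 1≤d
      0≤kkSμ : 0ℚ ≤ kq * kq * S * μ
      0≤kkSμ = 0≤* (0≤* (0≤* (0≤ℕtoℚ k) (0≤ℕtoℚ k)) 0≤S) 0≤μ

    degreeFactor : ℚ
    degreeFactor = S * (ℕtoℚ 8 * (kq * kq)) * μ

    densityConstant : ℚ
    densityConstant = ℕtoℚ 16384 * ((kq ^ℚ 3) * ((S ^ℚ 2) * μ))

    private
      4·degreeFactor≤densityConstant : ℕtoℚ 4 * degreeFactor ≤ densityConstant
      4·degreeFactor≤densityConstant = begin
          ℕtoℚ 4 * degreeFactor
            ≡⟨ solve 5 (λ f e s k u → f :* (s :* (e :* (k :* k)) :* u) := (f :* e) :* (k :* k :* s :* u)) refl (ℕtoℚ 4) (ℕtoℚ 8) S kq μ ⟩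
          (ℕtoℚ 4 * ℕtoℚ 8) * (kq * kq * S * μ)
            ≤⟨ *-mono-≤-nonNeg (0≤* (0≤ℕtoℚ 4) (0≤ℕtoℚ 8)) 0≤kkSμ
                 (≤-trans (≤-reflexive (sym (ℕtoℚ-* 4 8))) (ℕtoℚ-mono-≤ {32} {16384} (ℕ.m≤m+n 32 16352)))
                 (≤-trans (≤-reflexive (sym (*-identityʳ (kq * kq * S * μ)))) (*-monoˡ-≤-nonNeg (kq * kq * S * μ) {{nonNegative 0≤kkSμ}}
                   (≤-trans (≤-reflexive (sym (*-identityʳ 1ℚ))) (*-mono-≤-nonNeg 0≤1 0≤1 (ℕtoℚ-mono-≤ {1} {k} (s≤s z≤n)) 1≤S)))) ⟩
          ℕtoℚ 16384 * (kq * kq * S * μ * (kq * S))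
            ≡⟨ solve 4 (λ e k s u → e :* (k :* k :* s :* u :* (k :* s)) := e :* ((k :* (k :* (k :* con 1ℚ))) :* ((s :* (s :* con 1ℚ)) :* u)))
                 refl (ℕtoℚ 16384) kq S μ ⟩
          densityConstant ∎
        where open ≤-Reasoning

    -- With c = degreeFactor: 4ᵏ (c d)ᵏ n ≤ (2¹⁴k³S²μ)ᵏ n dᵏ ≤ d²ᵏ = 4ᵏ (d/2)²ᵏ; then cancel 4ᵏ.
    density-bound : ∀ n → densityConstant ^ℚ k * ℕtoℚ n ≤ d ^ℚ k →
      (degreeFactor * d) ^ℚ k * ℕtoℚ n ≤ (d * ½) ^ℚ k * (d * ½) ^ℚ k
    density-bound n density = *-cancelˡ-≤-pos (ℕtoℚ 4 ^ℚ k) {{positive (0<^ k (positive⁻¹ (ℕtoℚ 4)))}} (begin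
        ℕtoℚ 4 ^ℚ k * ((degreeFactor * d) ^ℚ k * nq)
          ≡⟨ cong (λ t → ℕtoℚ 4 ^ℚ k * (t * nq)) (^-distribʳ-* degreeFactor d k) ⟩
        ℕtoℚ 4 ^ℚ k * (degreeFactor ^ℚ k * d ^ℚ k * nq)
          ≡⟨ solve 4 (λ f c d n → f :* (c :* d :* n) := (f :* c) :* n :* d) refl (ℕtoℚ 4 ^ℚ k) (degreeFactor ^ℚ k) (d ^ℚ k) nq ⟩
        (ℕtoℚ 4 ^ℚ k * degreeFactor ^ℚ k) * nq * d ^ℚ k
          ≡⟨ cong (λ t → t * nq * d ^ℚ k) (sym (^-distribʳ-* (ℕtoℚ 4) degreeFactor k)) ⟩
        (ℕtoℚ 4 * degreeFactor) ^ℚ k * nq * d ^ℚ k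
          ≤⟨ *-monoʳ-≤-nonNeg (d ^ℚ k) {{nonNegative (0≤^ k 0≤d)}}
               (≤-trans (*-monoʳ-≤-nonNeg nq {{nonNegative (0≤ℕtoℚ n)}}
                 (^-mono-≤ k (0≤* (0≤ℕtoℚ 4) 0≤degreeFactor) 4·degreeFactor≤densityConstant)) density) ⟩
        d ^ℚ k * d ^ℚ k
          ≡⟨ sym (^-distribʳ-* d d k) ⟩
        (d * d) ^ℚ k
          ≡⟨ cong (_^ℚ k) (solve 1 (λ d → d :* d := con (ℕtoℚ 4) :* ((d :* con ½) :* (d :* con ½))) refl d) ⟩
        (ℕtoℚ 4 * ((d * ½) * (d * ½))) ^ℚ k
          ≡⟨ trans (^-distribʳ-* (ℕtoℚ 4) ((d * ½) * (d * ½)) k) (cong (ℕtoℚ 4 ^ℚ k *_) (^-distribʳ-* (d * ½) (d * ½) k)) ⟩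
        ℕtoℚ 4 ^ℚ k * ((d * ½) ^ℚ k * (d * ½) ^ℚ k) ∎)
      where
      open ≤-Reasoning
      nq = ℕtoℚ n
      0≤degreeFactor : 0ℚ ≤ degreeFactor
      0≤degreeFactor = 0≤* (0≤* 0≤S (0≤* (0≤ℕtoℚ 8) (0≤* (0≤ℕtoℚ k) (0≤ℕtoℚ k)))) 0≤μ

    -- With T = S · 8k² · D: first S·hom* ≤ T·H, then (T·H)ᵏ ≤ Tᵏ n homᴷ ≤ δ²ᵏ homᴷ ≤ homᵏ.
    S·hom*≤hom : ∀ (n D δ hS hM H : ℕ) → densityConstant ^ℚ k * ℕtoℚ n ≤ d ^ℚ k →
      ℕtoℚ D ≤ μ * d → d * ½ ≤ ℕtoℚ δ →
      hS ℕ.≤ 8 ℕ.* (k ℕ.* k) ℕ.* (D ℕ.* H) →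
      H ℕ.^ k ℕ.≤ n ℕ.* hM ℕ.^ K →
      δ ℕ.^ k ℕ.* δ ℕ.^ k ℕ.≤ hM →
      S * ℕtoℚ hS ≤ ℕtoℚ hM
    S·hom*≤hom n D δ hS hM H density D≤μd d/2≤δ hS≤ H^k≤ δ²ᵏ≤hM =
      ≤-trans S·hS≤T·H (^-cancel-≤ K (0≤* 0≤T (0≤ℕtoℚ H)) (0≤ℕtoℚ hM) [T·H]ᵏ≤hMᵏ)
      where
      open ≤-Reasoning
      q : ℕ → ℚ
      q = ℕtoℚ
      T = S * (q 8 * (kq * kq)) * q D
      0≤S·8k² : 0ℚ ≤ S * (q 8 * (kq * kq))
      0≤S·8k² = 0≤* 0≤S (0≤* (0≤ℕtoℚ 8) (0≤* (0≤ℕtoℚ k) (0≤ℕtoℚ k)))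
      0≤T : 0ℚ ≤ T
      0≤T = 0≤* 0≤S·8k² (0≤ℕtoℚ D)

      S·hS≤T·H : S * q hS ≤ T * q H
      S·hS≤T·H = begin
          S * q hS                              ≤⟨ *-monoˡ-≤-nonNeg S {{nonNegative 0≤S}} (ℕtoℚ-mono-≤ hS≤) ⟩
          S * q (8 ℕ.* (k ℕ.* k) ℕ.* (D ℕ.* H))  ≡⟨ cong (S *_) (trans (ℕtoℚ-* (8 ℕ.* (k ℕ.* k)) (D ℕ.* H))
                                                     (cong₂ _*_ (trans (ℕtoℚ-* 8 (k ℕ.* k)) (cong (q 8 *_) (ℕtoℚ-* k k))) (ℕtoℚ-* D H))) ⟩
          S * (q 8 * (kq * kq) * (q D * q H))   ≡⟨ solve 4 (λ s e d h → s :* (e :* (d :* h)) := s :* e :* d :* h) refl S (q 8 * (kq * kq)) (q D) (q H) ⟩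
          T * q H                               ∎

      T≤degreeFactor·d : T ≤ degreeFactor * d
      T≤degreeFactor·d = begin
          T                                 ≤⟨ *-monoˡ-≤-nonNeg (S * (q 8 * (kq * kq))) {{nonNegative 0≤S·8k²}} D≤μd ⟩
          S * (q 8 * (kq * kq)) * (μ * d)   ≡⟨ sym (*-assoc (S * (q 8 * (kq * kq))) μ d) ⟩
          degreeFactor * d                  ∎

      Tᵏn≤δ²ᵏ : T ^ℚ k * q n ≤ q δ ^ℚ k * q δ ^ℚ k
      Tᵏn≤δ²ᵏ = begin
          T ^ℚ k * q n                       ≤⟨ *-monoʳ-≤-nonNeg (q n) {{nonNegative (0≤ℕtoℚ n)}} (^-mono-≤ k 0≤T T≤degreeFactor·d) ⟩
          (degreeFactor * d) ^ℚ k * q n      ≤⟨ density-bound n density ⟩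
          (d * ½) ^ℚ k * (d * ½) ^ℚ k        ≤⟨ *-mono-≤-nonNeg (0≤^ k 0≤d/2) (0≤^ k 0≤d/2) (^-mono-≤ k 0≤d/2 d/2≤δ)
                                                                (^-mono-≤ k 0≤d/2 d/2≤δ) ⟩
          q δ ^ℚ k * q δ ^ℚ k                ∎
        where
        0≤d/2 : 0ℚ ≤ d * ½
        0≤d/2 = 0≤* 0≤d (<⇒≤ (positive⁻¹ ½))

      [T·H]ᵏ≤hMᵏ : (T * q H) ^ℚ k ≤ q hM ^ℚ k
      [T·H]ᵏ≤hMᵏ = begin
          (T * q H) ^ℚ k                    ≡⟨ ^-distribʳ-* T (q H) k ⟩
          T ^ℚ k * q H ^ℚ k                 ≤⟨ *-monoˡ-≤-nonNeg (T ^ℚ k) {{nonNegative (0≤^ k 0≤T)}} (begin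
              q H ^ℚ k                      ≡⟨ sym (ℕtoℚ-^ H k) ⟩
              q (H ℕ.^ k)                   ≤⟨ ℕtoℚ-mono-≤ H^k≤ ⟩
              q (n ℕ.* hM ℕ.^ K)            ≡⟨ trans (ℕtoℚ-* n (hM ℕ.^ K)) (cong (q n *_) (ℕtoℚ-^ hM K)) ⟩
              q n * q hM ^ℚ K               ∎) ⟩
          T ^ℚ k * (q n * q hM ^ℚ K)        ≡⟨ sym (*-assoc (T ^ℚ k) (q n) (q hM ^ℚ K)) ⟩
          T ^ℚ k * q n * q hM ^ℚ K          ≤⟨ *-monoʳ-≤-nonNeg (q hM ^ℚ K) {{nonNegative (0≤^ K (0≤ℕtoℚ hM))}} (≤-trans Tᵏn≤δ²ᵏ (begin
              q δ ^ℚ k * q δ ^ℚ k           ≡⟨ sym (trans (ℕtoℚ-* (δ ℕ.^ k) (δ ℕ.^ k)) (cong₂ _*_ (ℕtoℚ-^ δ k) (ℕtoℚ-^ δ k))) ⟩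
              q (δ ℕ.^ k ℕ.* δ ℕ.^ k)       ≤⟨ ℕtoℚ-mono-≤ δ²ᵏ≤hM ⟩
              q hM                          ∎)) ⟩
          q hM * q hM ^ℚ K                  ∎

open import Data.Fin using (zero)
open import Data.Rational using (ℚ; _≤_; _<_; _*_; ½; 0ℚ; 1ℚ)
open import Relation.Binary.PropositionalEquality using (subst; subst₂; sym)
open RationalArithmetic using (S·hom*≤hom)

lemma16 : (n : ℕ) (d μ S η : ℚ) (k : ℕ) →
    n ≥ 1 → 1ℚ ≤ d → 1ℚ ≤ μ → 1ℚ ≤ S → k ≥ 1 →
    0ℚ < η → η < 1ℚ →
    -- d ≥ 2^14 k^3 S^2 μ n^{1/k}, written (both sides positive) as
    -- d^k ≥ (2^14 k^3 S^2 μ)^k n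
    ((ℕtoℚ 16384 * ((ℕtoℚ k ^ℚ 3) * ((S ^ℚ 2) * μ))) ^ℚ k) * ℕtoℚ n ≤ d ^ℚ k →
    (G : Graph n) (c : ProperEdgeColouring G) →
    (∀ (x : Fin n) → d * ½ ≤ ℕtoℚ (deg G x)) →
    (∀ (x : Fin n) → ℕtoℚ (deg G x) ≤ μ * d) →
    -- hom*(C_{2k}) ≤ (1/S) hom(C_{2k}), written as S · hom* ≤ hom (S ≥ 1 > 0)
    S * ℕtoℚ (homStar G c k) ≤ ℕtoℚ (hom G c k)
lemma16 (suc n) d μ S _ (suc K) n≥1 1≤d 1≤μ 1≤S _ _ _ density G c d/2≤deg deg≤μd =
  S·hom*≤hom K d μ S 1≤d 1≤μ 1≤S (suc n) D δ (homStar G c (suc K)) (hom G c (suc K)) (closedWalks (K + K))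
    density D≤μd d/2≤δ (homStar-≤ D (degree≤max zero) colourBound col<colourBound K) log-convexity lower-bound
  where
  open import Data.Nat using (_+_; _^_) renaming (_*_ to _*′_; _≤_ to _≤′_)
  open AdjacencyMarks G c
  open NonRainbowWalks G c using (homStar-≤)
  open HomCount G c using (hom≡closedWalks)
  D = degree (maxDegreeVertex zero)
  δ = degree (minDegreeVertex zero)
  D≤μd : ℕtoℚ D ≤ μ * d
  D≤μd = subst (λ t → ℕtoℚ t ≤ μ * d) (deg≡degree (maxDegreeVertex zero)) (deg≤μd (maxDegreeVertex zero))
  d/2≤δ : d * ½ ≤ ℕtoℚ δ
  d/2≤δ = subst (λ t → d * ½ ≤ ℕtoℚ t) (deg≡degree (minDegreeVertex zero)) (d/2≤deg (minDegreeVertex zero))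
  log-convexity : closedWalks (K + K) ^ suc K ≤′ suc n *′ hom G c (suc K) ^ K
  log-convexity = subst₂ (λ a b → closedWalks (K + K) ^ suc K ≤′ a *′ b ^ K) closedWalks-0 (sym (hom≡closedWalks K))
                         (closedWalks-power-bound K)
  lower-bound : δ ^ suc K *′ δ ^ suc K ≤′ hom G c (suc K)
  lower-bound = subst (δ ^ suc K *′ δ ^ suc K ≤′_) (sym (hom≡closedWalks K)) (closedWalks-lower-bound δ (min≤degree zero) n≥1 (suc K))
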